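{- Let $w\in S_n$ be a nonidentity sorted permutation with orthodontic sequence $\bm{i}(w)=(i_1,\ldots,i_\ell)$, $\bm{k}(w)=(k_1,\ldots,k_n)$, $\bm{m}(w)=(m_1,\ldots,m_\ell)$, and primary column data $(h,C,\alpha,i_1,\beta)$ (the first entry of $\bm{i}(w)$ being this $i_1$). Then: (i) for $j\in[\beta]$, $i_j=i_1-j+1$; (ii) if $\alpha>0$ then $k_\alpha\ge\beta$; (iii) for $j\in[\alpha+1,i_1]$, $k_j=0$; (iv) for $j\in[\beta-1]$, $m_j=0$; (v) the permutation $ws_{i_1}s_{i_1-1}\cdots s_{\alpha+1}$ has orthodontic sequence $\bm{i}=(i_{\beta+1},\ldots,i_\ell)$, $\bm{m}=(m_{\beta+1},\ldots,m_\ell)$, and $\bm{k}=(k_1,\ldots,k_{\alpha-1},k_\alpha-\beta,\beta+m_\beta,k_{\alpha+2},\ldots,k_n)$ if $\alpha>0$, respectively $\bm{k}=(\beta+m_\beta,k_2,\ldots,k_n)$ if $\alpha=0$.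
   Context: $[m,n]=\{m,\ldots,n\}$, $[n]=[1,n]$, $[0]=\emptyset$. $s_j$ adjacent transposition; permutations act on the right on positions, so $ws_j$ is $w$ with $w(j),w(j+1)$ swapped. Rothe diagram $D(w)=\{(i,j)\in[n]^2: i<w^{ -1}(j),\ j<w(i)\}$ (row $i$, column $j$), columns $D(w)_j=\{i:(i,j)\in D(w)\}$. Standard interval: $[j]$, $j\ge0$. Dominant: all columns of $D(w)$ are standard intervals. Missing tooth of a column $C$: $i\ge1$ with $i\notin C$, $i+1\in C$. Primary column data: if $w$ is not dominant, $h$ minimal with $D(w)_{h+1}$ not a standard interval, $C=D(w)_{h+1}$, $\alpha$ maximal with $[\alpha]\subseteq C$, $i_1$ the smallest missing tooth of $C$, $\beta=i_1-\alpha$; if $w$ dominant, $(h,C,\alpha,i_1,\beta)=(n,\emptyset,0,n,n)$. Then $w$ maps $[\alpha+1,i_1]$ bijectively onto $[h-\beta+1,h]$; $\sigma(w)\in S_\beta$ is $\sigma(w)(p)=w(\alpha+p)-(h-\beta)$; $w$ is sorted if $\sigma(w)$ is the identity, i.e. $w(\alpha+1)<\cdots<w(i_1)$. Orthodontic sequence: start with $D=D(w)$. For $j\in[n]$ let $k_j$ be the number of columns equal to $[j]$; replace them by empty columns. If nonempty columns remain, let $i_1$ be the smallest missing tooth of the leftmost nonempty column and swap rows $i_1,i_1+1$. Then $m_1$ is the number of columns equal to $[i_1]$ in the new diagram; empty them, let $i_2$ be the smallest missing tooth of the leftmost nonempty column, swap rows $i_2,i_2+1$, let $m_2$ be the number of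 columns equal to $[i_2]$, empty them, etc., until no nonempty columns remain after $\ell$ swaps. Output $\bm{i}(w)=(i_1,\ldots,i_\ell)$, $\bm{k}(w)=(k_1,\ldots,k_n)$, $\bm{m}(w)=(m_1,\ldots,m_\ell)$. -}

module Defs where

open import Data.Nat using (ℕ; zero; suc; _+_; _∸_; _≤_; _<_; _≤ᵇ_; _<ᵇ_; _≡ᵇ_; _<?_)
open import Data.Bool using (Bool; true; false; _∧_; not; if_then_else_)
open import Data.Fin using (Fin; toℕ; fromℕ<)
open import Data.Fin.Permutation using (Permutation′; _⟨$⟩ʳ_; _⟨$⟩ˡ_; transpose; _∘ₚ_; id)
open import Data.List using (List; []; _∷_; map; upTo; length; filterᵇ)
open import Data.Bool.ListAction using (all; any)
open import Data.Maybe using (Maybe; just; nothing)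
open import Data.Product using (Σ; _×_; _,_; ∃)
open import Relation.Nullary using (¬_; yes; no)
open import Relation.Binary.PropositionalEquality using (_≡_)
open import Data.Nat.Properties using (<-trans; n<1+n)

-- Conventions: rows, columns and values are 1-based natural numbers.
-- A permutation w ∈ S_n is a library permutation  Permutation′ n  of Fin n;
-- it is read on [1,n] via  app  (position i ↦ w(i)) and  appInv  (w⁻¹).

[1,_] : ℕ → List ℕ
[1, n ] = map suc (upTo n)

-- w(i) for 1 ≤ i ≤ n (junk value i outside [1,n])
app : ∀ {n} → Permutation′ n → ℕ → ℕ
app {n} w zero = zero
app {n} w (suc k) with k <? n
... | yes k<n = suc (toℕ (w ⟨$⟩ʳ fromℕ< k<n))
... | no  _   = suc k

appInv : ∀ {n} → Permutation′ n → ℕ → ℕ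
appInv {n} w zero = zero
appInv {n} w (suc k) with k <? n
... | yes k<n = suc (toℕ (w ⟨$⟩ˡ fromℕ< k<n))
... | no  _   = suc k

-- right multiplication by the adjacent transposition s_j (1 ≤ j < n):
-- (w s_j)(x) = w(s_j(x)), i.e. w with the values in positions j, j+1 swapped.
-- (For j ∉ [1,n-1], s_j is not defined; we use the identity as junk.)
_·s_ : ∀ {n} → Permutation′ n → ℕ → Permutation′ n
_·s_ {n} w zero = w
_·s_ {n} w (suc k) with suc k <? n
... | yes j+1<n = transpose (fromℕ< (<-trans (n<1+n k) j+1<n))
                            (fromℕ< j+1<n) ∘ₚ w
... | no  _     = w

_·sList_ : ∀ {n} → Permutation′ n → List ℕ → Permutation′ n
w ·sList []       = w
w ·sList (j ∷ js) = (w ·s j) ·sList js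

-- Diagrams: D r c = true iff the cell in row r, column c belongs to D.
-- Only cells of [1,n]² are relevant.

Diagram : Set
Diagram = ℕ → ℕ → Bool

rothe : ∀ {n} → Permutation′ n → Diagram
rothe {n} w i j =
  (1 ≤ᵇ i) ∧ (i ≤ᵇ n) ∧ (1 ≤ᵇ j) ∧ (j ≤ᵇ n) ∧ (i <ᵇ appInv w j) ∧ (j <ᵇ app w i)

_==_ : Bool → Bool → Bool
true  == b = b
false == b = not b

colIsᵇ : ℕ → Diagram → ℕ → ℕ → Bool
colIsᵇ n D c j = all (λ r → D r c == (r ≤ᵇ j)) [1, n ]

colEmptyᵇ : ℕ → Diagram → ℕ → Bool
colEmptyᵇ n D c = colIsᵇ n D c 0

colStdᵇ : ℕ → Diagram → ℕ → Bool
colStdᵇ n D c = any (λ j → colIsᵇ n D c j) (0 ∷ [1, n ])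

countCols : ℕ → Diagram → ℕ → ℕ
countCols n D j = length (filterᵇ (λ c → colIsᵇ n D c j) [1, n ])

emptyColsEq : ℕ → Diagram → ℕ → Diagram
emptyColsEq n D j r c = if colIsᵇ n D c j then false else D r c

emptyStdCols : ℕ → Diagram → Diagram
emptyStdCols n D r c = if any (λ j → colIsᵇ n D c j) [1, n ] then false else D r c

swapRows : ℕ → Diagram → Diagram
swapRows i D r c =
  if r ≡ᵇ i then D (suc i) c else if r ≡ᵇ suc i then D i c else D r c

MissingTooth : Diagram → ℕ → ℕ → Set
MissingTooth D c i = 1 ≤ i × D i c ≡ false × D (suc i) c ≡ true

SmallestMissingTooth : Diagram → ℕ → ℕ → Set
SmallestMissingTooth D c i =
  MissingTooth D c i × (∀ i′ → i′ < i → ¬ MissingTooth D c i′)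

LeftmostNonempty : ℕ → Diagram → ℕ → Set
LeftmostNonempty n D c =
  1 ≤ c × c ≤ n × colEmptyᵇ n D c ≡ false ×
  (∀ c′ → 1 ≤ c′ → c′ < c → colEmptyᵇ n D c′ ≡ true)

AllEmpty : ℕ → Diagram → Set
AllEmpty n D = ∀ c → 1 ≤ c → c ≤ n → colEmptyᵇ n D c ≡ true

-- The loop of the orthodontic algorithm, started at diagram D:
-- OrthoLoop n D is ms  means that it performs the swaps is = (i₁,…,i_ℓ)
-- and records ms = (m₁,…,m_ℓ).
data OrthoLoop (n : ℕ) : Diagram → List ℕ → List ℕ → Set where
  done : ∀ {D} → AllEmpty n D → OrthoLoop n D [] []
  step : ∀ {D c i is ms} →
         LeftmostNonempty n D c →
         SmallestMissingTooth D c i →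
         OrthoLoop n (emptyColsEq n (swapRows i D) i) is ms →
         OrthoLoop n D (i ∷ is) (countCols n (swapRows i D) i ∷ ms)

Orthodontic : ∀ {n} → Permutation′ n → List ℕ → List ℕ → List ℕ → Set
Orthodontic {n} w is ks ms =
  ks ≡ map (countCols n (rothe w)) [1, n ] ×
  OrthoLoop n (emptyStdCols n (rothe w)) is ms

-- Primary column data (h, α, i₁, β); C is column h+1 of D(w).

Dominant : ∀ {n} → Permutation′ n → Set
Dominant {n} w = ∀ c → 1 ≤ c → c ≤ n → colStdᵇ n (rothe w) c ≡ true

data PrimaryData {n : ℕ} (w : Permutation′ n) : ℕ → ℕ → ℕ → ℕ → Set where
  dominant : Dominant w → PrimaryData w n 0 n n
  nondominant : ∀ {h α i₁} →
    h < n →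
    (∀ c → 1 ≤ c → c ≤ h → colStdᵇ n (rothe w) c ≡ true) →
    colStdᵇ n (rothe w) (suc h) ≡ false →
    (∀ r → 1 ≤ r → r ≤ α → rothe w r (suc h) ≡ true) →
    rothe w (suc α) (suc h) ≡ false →
    SmallestMissingTooth (rothe w) (suc h) i₁ →
    PrimaryData w h α i₁ (i₁ ∸ α)

SortedOn : ∀ {n} → Permutation′ n → ℕ → ℕ → Set
SortedOn w α i₁ = ∀ p → α < p → suc p ≤ i₁ → app w p < app w (suc p)

Sorted : ∀ {n} → Permutation′ n → Set
Sorted w = ∀ {h α i₁ β} → PrimaryData w h α i₁ β → SortedOn w α i₁

IsIdentity : ∀ {n} → Permutation′ n → Set
IsIdentity {n} w = ∀ i → w ⟨$⟩ʳ i ≡ i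

-- xs ! j = just x_j  (j ∈ [1, length xs]),  nothing otherwise
_!_ : List ℕ → ℕ → Maybe ℕ
[]       ! _           = nothing
(x ∷ xs) ! zero        = nothing
(x ∷ xs) ! suc zero    = just x
(x ∷ xs) ! suc (suc j) = xs ! suc j

-- x_j with junk 0
at : List ℕ → ℕ → ℕ
at []       _           = 0
at (x ∷ xs) zero        = 0
at (x ∷ xs) (suc zero)  = x
at (x ∷ xs) (suc (suc j)) = at xs (suc j)

drop : ℕ → List ℕ → List ℕ
drop zero xs = xs
drop (suc k) [] = []
drop (suc k) (x ∷ xs) = drop k xs

-- the list i₁, i₁-1, …, α+1  (β = i₁ - α entries)
descending : ℕ → ℕ → List ℕ
descending α i₁ = map (λ t → i₁ ∸ t) (upTo (i₁ ∸ α))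

newK : ℕ → List ℕ → ℕ → ℕ → ℕ → List ℕ
newK n ks zero    β mβ = map (λ j → if j ≡ᵇ 1 then β + mβ else at ks j) [1, n ]
newK n ks (suc a) β mβ =
  map (λ j → if j ≡ᵇ suc a then at ks (suc a) ∸ β
             else if j ≡ᵇ suc (suc a) then β + mβ else at ks j) [1, n ]

module Submission where

-- Write C = D(w)_{h+1}: [α] ⊆ C, the block of rows α+1, …, i₁ misses C and i₁+1 ∈ C.
-- Because the columns left of C are standard intervals and w is increasing on the block,
-- w maps the block onto the consecutive values L+1, …, h with L = h − β. So the columns of
-- D(w) are of three kinds: those ≤ L contain the whole block, the β columns in (L, h] all
-- equal [α], and those > h avoid the block. Multiplying w by s_{i₁} ⋯ s_{α+1} composes it
-- with a cycle moving row α+1 past the block: the β columns in (L, h] become [α+1], the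
-- others keep their shape. In the orthodontic loop, C stays the leftmost nonempty column
-- and its smallest missing tooth runs through i₁, i₁−1, …, α+1; these swaps realise the
-- same cycle on the rows and empty no column before the last one. Comparing column
-- counts gives (i)–(v).

open import Defs
import Data.Bool as Bool
open import Data.Bool using (Bool; T; true; false; _∧_; _∨_; if_then_else_)
open import Data.Bool.ListAction using (all; any)
open import Data.Bool.Properties using (¬-not; not-¬; ∨-identityʳ; ∨-zeroʳ; ∧-zeroʳ; T-≡)
open import Function using (_∘_; Equivalence)
open import Relation.Nullary.Decidable using (T?)
open import Data.Fin as Fin using (Fin; toℕ; fromℕ<)
import Data.Fin.Properties as Finₚ
open import Data.Fin.Permutation using (Permutation′; _⟨$⟩ʳ_; _⟨$⟩ˡ_; inverseˡ; inverseʳ)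
import Data.Fin.Permutation.Components as PC
open import Data.Empty using (⊥; ⊥-elim)
open import Data.List using (List; []; _∷_; map; applyUpTo; upTo; length; filterᵇ; _++_)
open import Data.List.Properties using (map-upTo; filter-++; length-++)
open import Data.Maybe using (just)
open import Data.Nat
open import Data.Nat.Properties
open import Data.Product using (_×_; _,_; ∃; proj₁; proj₂)
open import Data.Sum using (_⊎_; inj₁; inj₂)
open import Relation.Nullary using (¬_; yes; no)
open import Relation.Binary.PropositionalEquality
open import Relation.Binary.Definitions using (tri<; tri≈; tri>)

T⇒≡true : ∀ {b} → T b → b ≡ true
T⇒≡true = Equivalence.to T-≡

≡true⇒T : ∀ {b} → b ≡ true → T b
≡true⇒T = Equivalence.from T-≡

≤⇒≤ᵇ≡true : ∀ {m n} → m ≤ n → (m ≤ᵇ n) ≡ true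
≤⇒≤ᵇ≡true = T⇒≡true ∘ ≤⇒≤ᵇ

≤ᵇ≡true⇒≤ : ∀ {m n} → (m ≤ᵇ n) ≡ true → m ≤ n
≤ᵇ≡true⇒≤ = ≤ᵇ⇒≤ _ _ ∘ ≡true⇒T

<⇒<ᵇ≡true : ∀ {m n} → m < n → (m <ᵇ n) ≡ true
<⇒<ᵇ≡true = T⇒≡true ∘ <⇒<ᵇ

<ᵇ≡true⇒< : ∀ {m n} → (m <ᵇ n) ≡ true → m < n
<ᵇ≡true⇒< = <ᵇ⇒< _ _ ∘ ≡true⇒T

≡⇒≡ᵇ≡true : ∀ {m n} → m ≡ n → (m ≡ᵇ n) ≡ true
≡⇒≡ᵇ≡true = T⇒≡true ∘ ≡⇒≡ᵇ _ _

≡ᵇ≡true⇒≡ : ∀ {m n} → (m ≡ᵇ n) ≡ true → m ≡ n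
≡ᵇ≡true⇒≡ = ≡ᵇ⇒≡ _ _ ∘ ≡true⇒T

≰⇒≤ᵇ≡false : ∀ {m n} → m ≰ n → (m ≤ᵇ n) ≡ false
≰⇒≤ᵇ≡false m≰n = ¬-not (m≰n ∘ ≤ᵇ≡true⇒≤)

≢⇒≡ᵇ≡false : ∀ {m n} → m ≢ n → (m ≡ᵇ n) ≡ false
≢⇒≡ᵇ≡false m≢n = ¬-not (m≢n ∘ ≡ᵇ≡true⇒≡)

∧-intro : ∀ {a b} → a ≡ true → b ≡ true → (a ∧ b) ≡ true
∧-intro refl refl = refl

∧-elimˡ : ∀ {a b} → (a ∧ b) ≡ true → a ≡ true
∧-elimˡ {true} _ = refl

∧-elimʳ : ∀ {a b} → (a ∧ b) ≡ true → b ≡ true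
∧-elimʳ {true} b≡true = b≡true

true⇔true⇒≡ : ∀ {a b} → (a ≡ true → b ≡ true) → (b ≡ true → a ≡ true) → a ≡ b
true⇔true⇒≡ {true}  {true}  _ _ = refl
true⇔true⇒≡ {true}  {false} f _ = sym (f refl)
true⇔true⇒≡ {false} {true}  _ g = g refl
true⇔true⇒≡ {false} {false} _ _ = refl

range : ℕ → ℕ → List ℕ
range s zero    = []
range s (suc m) = suc s ∷ range (suc s) m

applyUpTo≡range : ∀ s m (f : ℕ → ℕ) → (∀ t → f t ≡ suc (s + t)) → applyUpTo f m ≡ range s m
applyUpTo≡range s zero    f f≗ = refl
applyUpTo≡range s (suc m) f f≗ =
  cong₂ _∷_ (trans (f≗ 0) (cong suc (+-identityʳ s)))
            (applyUpTo≡range (suc s) m (f ∘ suc) (λ t → trans (f≗ (suc t)) (cong suc (+-suc s t))))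

[1,n]≡range : ∀ n → [1, n ] ≡ range 0 n
[1,n]≡range n = trans (map-upTo suc n) (applyUpTo≡range 0 n suc (λ _ → refl))

InRange : ℕ → ℕ → ℕ → Set
InRange s m c = s < c × c ≤ s + m

InRange-tail : ∀ {s m c} → InRange (suc s) m c → InRange s (suc m) c
InRange-tail {s} {m} (s<c , c≤) = <-trans (n<1+n s) s<c , ≤-trans c≤ (≤-reflexive (sym (+-suc s m)))

InRange-head : ∀ s m → InRange s (suc m) (suc s)
InRange-head s m = n<1+n s , ≤-trans (s≤s (m≤m+n s m)) (≤-reflexive (sym (+-suc s m)))

InRange-empty : ∀ {s c} → ¬ InRange s 0 c
InRange-empty {s} (s<c , c≤s+0) = <-irrefl refl (≤-trans s<c (≤-trans c≤s+0 (≤-reflexive (+-identityʳ s))))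

InRange-split : ∀ {s m c} → InRange s (suc m) c → c ≡ suc s ⊎ InRange (suc s) m c
InRange-split {s} {m} {c} (s<c , c≤) with c ≟ suc s
... | yes c≡ = inj₁ c≡
... | no  c≢ = inj₂ (≤∧≢⇒< s<c (c≢ ∘ sym) , ≤-trans c≤ (≤-reflexive (+-suc s m)))

count : (ℕ → Bool) → List ℕ → ℕ
count p xs = length (filterᵇ p xs)

module _ (p : ℕ → Bool) where

  all-range⁻ : ∀ s m → all p (range s m) ≡ true → ∀ c → InRange s m c → p c ≡ true
  all-range⁻ s zero    _ c c∈ = ⊥-elim (InRange-empty c∈)
  all-range⁻ s (suc m) e c c∈ with InRange-split c∈
  ... | inj₁ refl = ∧-elimˡ e
  ... | inj₂ c∈′  = all-range⁻ (suc s) m (∧-elimʳ {p (suc s)} e) c c∈′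

  all-range⁺ : ∀ s m → (∀ c → InRange s m c → p c ≡ true) → all p (range s m) ≡ true
  all-range⁺ s zero    _ = refl
  all-range⁺ s (suc m) f = ∧-intro (f (suc s) (InRange-head s m)) (all-range⁺ (suc s) m (λ c → f c ∘ InRange-tail))

  any-range⁺ : ∀ s m c → InRange s m c → p c ≡ true → any p (range s m) ≡ true
  any-range⁺ s zero    c c∈ _ = ⊥-elim (InRange-empty c∈)
  any-range⁺ s (suc m) c c∈ pc with p (suc s) in ps | InRange-split c∈
  ... | true  | _         = refl
  ... | false | inj₁ refl = ⊥-elim (not-¬ ps pc)
  ... | false | inj₂ c∈′  = any-range⁺ (suc s) m c c∈′ pc

  any-range⁻ : ∀ s m → any p (range s m) ≡ true → ∃ λ c → InRange s m c × p c ≡ true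
  any-range⁻ s (suc m) e with p (suc s) in ps
  ... | true  = suc s , InRange-head s m , ps
  ... | false with any-range⁻ (suc s) m e
  ... | c , c∈ , pc = c , InRange-tail c∈ , pc

  count-range-none : ∀ s m → (∀ c → InRange s m c → p c ≡ false) → count p (range s m) ≡ 0
  count-range-none s zero    _ = refl
  count-range-none s (suc m) f rewrite f (suc s) (InRange-head s m) =
    count-range-none (suc s) m (λ c → f c ∘ InRange-tail)

  count-range-all : ∀ s m → (∀ c → InRange s m c → p c ≡ true) → count p (range s m) ≡ m
  count-range-all s zero    _ = refl
  count-range-all s (suc m) f rewrite f (suc s) (InRange-head s m) =
    cong suc (count-range-all (suc s) m (λ c → f c ∘ InRange-tail))

count-range-cong : ∀ (p q : ℕ → Bool) s m → (∀ c → InRange s m c → p c ≡ q c) →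
                   count p (range s m) ≡ count q (range s m)
count-range-cong p q s zero    _ = refl
count-range-cong p q s (suc m) f with p (suc s) | q (suc s) | f (suc s) (InRange-head s m)
... | true  | .true  | refl = cong suc (count-range-cong p q (suc s) m (λ c → f c ∘ InRange-tail))
... | false | .false | refl = count-range-cong p q (suc s) m (λ c → f c ∘ InRange-tail)

count-range-∨ : ∀ (p q r : ℕ → Bool) s m →
  (∀ c → InRange s m c → p c ≡ (q c ∨ r c)) →
  (∀ c → InRange s m c → q c ≡ true → r c ≡ false) →
  count p (range s m) ≡ count q (range s m) + count r (range s m)
count-range-∨ p q r s zero    _ _ = refl
count-range-∨ p q r s (suc m) f g
  with p (suc s) | q (suc s) in qs | r (suc s) in rs | f (suc s) (InRange-head s m)
... | _     | true  | true  | _    = ⊥-elim (not-¬ (g (suc s) (InRange-head s m) qs) rs)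
... | .true | true  | false | refl = cong suc IH
  where IH = count-range-∨ p q r (suc s) m (λ c → f c ∘ InRange-tail) (λ c → g c ∘ InRange-tail)
... | .true | false | true  | refl = trans (cong suc IH) (sym (+-suc _ _))
  where IH = count-range-∨ p q r (suc s) m (λ c → f c ∘ InRange-tail) (λ c → g c ∘ InRange-tail)
... | .false | false | false | refl = count-range-∨ p q r (suc s) m (λ c → f c ∘ InRange-tail) (λ c → g c ∘ InRange-tail)

range-++ : ∀ s m₁ m₂ → range s (m₁ + m₂) ≡ range s m₁ ++ range (s + m₁) m₂
range-++ s zero     m₂ = cong (λ z → range z m₂) (sym (+-identityʳ s))
range-++ s (suc m₁) m₂ =
  cong (suc s ∷_) (trans (range-++ (suc s) m₁ m₂) (cong (λ z → range (suc s) m₁ ++ range z m₂) (sym (+-suc s m₁))))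

count-++ : ∀ p xs ys → count p (xs ++ ys) ≡ count p xs + count p ys
count-++ p xs ys = trans (cong length (filter-++ (T? ∘ p) xs ys)) (length-++ (filterᵇ p xs))

between : ℕ → ℕ → ℕ → Bool
between L U c = (L <ᵇ c) ∧ (c ≤ᵇ U)

count-between : ∀ L U n → L ≤ U → U ≤ n → count (between L U) (range 0 n) ≡ U ∸ L
count-between L U n L≤U U≤n = begin
  count B (range 0 n)                                          ≡⟨ cong (count B) split ⟩
  count B (range 0 L ++ range L (U ∸ L) ++ range U (n ∸ U))    ≡⟨ count-++ B (range 0 L) _ ⟩
  count B (range 0 L) + count B (range L (U ∸ L) ++ range U (n ∸ U))
     ≡⟨ cong (count B (range 0 L) +_) (count-++ B (range L (U ∸ L)) _) ⟩
  count B (range 0 L) + (count B (range L (U ∸ L)) + count B (range U (n ∸ U)))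
     ≡⟨ cong₂ _+_ below (cong₂ _+_ inside above) ⟩
  0 + ((U ∸ L) + 0)                                            ≡⟨ +-identityʳ (U ∸ L) ⟩
  U ∸ L                                                        ∎
  where
    open ≡-Reasoning
    B = between L U
    split : range 0 n ≡ range 0 L ++ range L (U ∸ L) ++ range U (n ∸ U)
    split = begin
      range 0 n                                          ≡⟨ cong (range 0) (sym n≡) ⟩
      range 0 (L + ((U ∸ L) + (n ∸ U)))                  ≡⟨ range-++ 0 L _ ⟩
      range 0 L ++ range L ((U ∸ L) + (n ∸ U))           ≡⟨ cong (range 0 L ++_) (range-++ L (U ∸ L) (n ∸ U)) ⟩
      range 0 L ++ range L (U ∸ L) ++ range (L + (U ∸ L)) (n ∸ U)
         ≡⟨ cong (λ s → range 0 L ++ range L (U ∸ L) ++ range s (n ∸ U)) (m+[n∸m]≡n L≤U) ⟩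
      range 0 L ++ range L (U ∸ L) ++ range U (n ∸ U)    ∎
      where
        n≡ : L + ((U ∸ L) + (n ∸ U)) ≡ n
        n≡ = trans (sym (+-assoc L (U ∸ L) (n ∸ U))) (trans (cong (_+ (n ∸ U)) (m+[n∸m]≡n L≤U)) (m+[n∸m]≡n U≤n))
    below : count B (range 0 L) ≡ 0
    below = count-range-none B 0 L (λ c (_ , c≤L) → cong (_∧ (c ≤ᵇ U)) (¬-not (λ L<c → <-irrefl refl (≤-trans (<ᵇ≡true⇒< L<c) c≤L))))
    inside : count B (range L (U ∸ L)) ≡ U ∸ L
    inside = count-range-all B L (U ∸ L) (λ c (L<c , c≤) → ∧-intro (<⇒<ᵇ≡true L<c) (≤⇒≤ᵇ≡true (≤-trans c≤ (≤-reflexive (m+[n∸m]≡n L≤U)))))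
    above : count B (range U (n ∸ U)) ≡ 0
    above = count-range-none B U (n ∸ U) (λ c (U<c , _) → trans (cong ((L <ᵇ c) ∧_) (≰⇒≤ᵇ≡false (<⇒≱ U<c))) (∧-zeroʳ _))

at-map-range : ∀ (F : ℕ → ℕ) s m i → 1 ≤ i → i ≤ m → at (map F (range s m)) i ≡ F (s + i)
at-map-range F s (suc m) (suc zero)    _ _         = cong F (sym (trans (+-suc s 0) (cong suc (+-identityʳ s))))
at-map-range F s (suc m) (suc (suc i)) _ (s≤s i≤m) =
  trans (at-map-range F (suc s) m (suc i) (s≤s z≤n) i≤m) (cong F (sym (+-suc s (suc i))))

!-map-range : ∀ (F : ℕ → ℕ) s m i → 1 ≤ i → i ≤ m → map F (range s m) ! i ≡ just (F (s + i))
!-map-range F s (suc m) (suc zero)    _ _         = cong (just ∘ F) (sym (trans (+-suc s 0) (cong suc (+-identityʳ s))))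
!-map-range F s (suc m) (suc (suc i)) _ (s≤s i≤m) =
  trans (!-map-range F (suc s) m (suc i) (s≤s z≤n) i≤m) (cong (just ∘ F) (sym (+-suc s (suc i))))

map-range-cong : ∀ (F G : ℕ → ℕ) s m → (∀ c → InRange s m c → F c ≡ G c) → map F (range s m) ≡ map G (range s m)
map-range-cong F G s zero    _ = refl
map-range-cong F G s (suc m) f =
  cong₂ _∷_ (f (suc s) (InRange-head s m)) (map-range-cong F G (suc s) m (λ c → f c ∘ InRange-tail))

module _ {n : ℕ} (w : Permutation′ n) where

  app-suc : ∀ {k} (k<n : k < n) → app w (suc k) ≡ suc (toℕ (w ⟨$⟩ʳ fromℕ< k<n))
  app-suc {k} k<n with k <? n
  ... | yes _   = refl
  ... | no  k≮n = ⊥-elim (k≮n k<n)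

  appInv-suc : ∀ {k} (k<n : k < n) → appInv w (suc k) ≡ suc (toℕ (w ⟨$⟩ˡ fromℕ< k<n))
  appInv-suc {k} k<n with k <? n
  ... | yes _   = refl
  ... | no  k≮n = ⊥-elim (k≮n k<n)

  app-toℕ : ∀ (i : Fin n) → app w (suc (toℕ i)) ≡ suc (toℕ (w ⟨$⟩ʳ i))
  app-toℕ i = trans (app-suc (Finₚ.toℕ<n i)) (cong (λ j → suc (toℕ (w ⟨$⟩ʳ j))) (Finₚ.fromℕ<-toℕ i _))

  app-out : ∀ {r} → n < r → app w r ≡ r
  app-out {suc k} n<r with k <? n
  ... | yes k<n = ⊥-elim (<⇒≱ k<n (s≤s⁻¹ n<r))
  ... | no  _   = refl

  app-range : ∀ {r} → 1 ≤ r → r ≤ n → 1 ≤ app w r × app w r ≤ n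
  app-range {suc k} _ r≤n rewrite app-suc r≤n = s≤s z≤n , Finₚ.toℕ<n _

  appInv-range : ∀ {r} → 1 ≤ r → r ≤ n → 1 ≤ appInv w r × appInv w r ≤ n
  appInv-range {suc k} _ r≤n rewrite appInv-suc r≤n = s≤s z≤n , Finₚ.toℕ<n _

  appInv-app : ∀ {r} → 1 ≤ r → r ≤ n → appInv w (app w r) ≡ r
  appInv-app {suc k} _ r≤n rewrite app-suc r≤n | appInv-suc (Finₚ.toℕ<n (w ⟨$⟩ʳ fromℕ< r≤n)) =
    cong suc (trans (cong (λ j → toℕ (w ⟨$⟩ˡ j)) (Finₚ.fromℕ<-toℕ _ _))
                    (trans (cong toℕ (inverseˡ w)) (Finₚ.toℕ-fromℕ< r≤n)))

  app-appInv : ∀ {r} → 1 ≤ r → r ≤ n → app w (appInv w r) ≡ r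
  app-appInv {suc k} _ r≤n rewrite appInv-suc r≤n | app-suc (Finₚ.toℕ<n (w ⟨$⟩ˡ fromℕ< r≤n)) =
    cong suc (trans (cong (λ j → toℕ (w ⟨$⟩ʳ j)) (Finₚ.fromℕ<-toℕ _ _))
                    (trans (cong toℕ (inverseʳ w)) (Finₚ.toℕ-fromℕ< r≤n)))

  app≡⇒appInv≡ : ∀ {r c} → 1 ≤ r → r ≤ n → app w r ≡ c → appInv w c ≡ r
  app≡⇒appInv≡ 1≤r r≤n refl = appInv-app 1≤r r≤n

swap : ℕ → ℕ → ℕ
swap j r = if r ≡ᵇ j then suc j else if r ≡ᵇ suc j then j else r

swap-≢ : ∀ {j r} → r ≢ j → r ≢ suc j → swap j r ≡ r
swap-≢ {j} {r} r≢j r≢j+1 rewrite ≢⇒≡ᵇ≡false r≢j | ≢⇒≡ᵇ≡false r≢j+1 = refl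

swap-left : ∀ j → swap j j ≡ suc j
swap-left j rewrite ≡⇒≡ᵇ≡true {j} refl = refl

swap-right : ∀ j → swap j (suc j) ≡ j
swap-right j rewrite ≢⇒≡ᵇ≡false {suc j} {j} (<⇒≢ (n<1+n j) ∘ sym) | ≡⇒≡ᵇ≡true {j} refl = refl

swapRows≡swap : ∀ i (D : Diagram) r c → swapRows i D r c ≡ D (swap i r) c
swapRows≡swap i D r c with r ≡ᵇ i
... | true  = refl
... | false with r ≡ᵇ suc i
... | true  = refl
... | false = refl

transpose-toℕ : ∀ {m} (i j k : Fin m) → toℕ j ≡ suc (toℕ i) →
                suc (toℕ (PC.transpose i j k)) ≡ swap (suc (toℕ i)) (suc (toℕ k))
transpose-toℕ i j k j≡i+1 with k Fin.≟ i
... | yes refl rewrite j≡i+1 = sym (swap-left (suc (toℕ i)))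
... | no k≢i with k Fin.≟ j
... | yes refl rewrite j≡i+1 = sym (swap-right (suc (toℕ i)))
... | no k≢j = sym (swap-≢ (k≢i ∘ Finₚ.toℕ-injective ∘ suc-injective)
                           (λ e → k≢j (Finₚ.toℕ-injective (trans (suc-injective e) (sym j≡i+1)))))

app-·s : ∀ {n} (w : Permutation′ n) {j} → 1 ≤ j → j < n → ∀ r → app (w ·s j) r ≡ app w (swap j r)
app-·s {n} w {suc j} _ j+1<n r with suc j <? n
... | no j+1≮n = ⊥-elim (j+1≮n j+1<n)
app-·s {n} w {suc j} _ j+1<n zero    | yes _ = refl
app-·s {n} w {suc j} _ j+1<n (suc k) | yes j+1<n′ with k <? n
... | yes k<n = trans (sym (app-toℕ w (PC.transpose A B K)))
                      (cong (app w) (trans (transpose-toℕ A B K B≡A+1)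
                        (cong₂ (λ u v → swap (suc u) (suc v)) (Finₚ.toℕ-fromℕ< _) (Finₚ.toℕ-fromℕ< k<n))))
  where
    A = fromℕ< (<-trans (n<1+n j) j+1<n′)
    B = fromℕ< j+1<n′
    K = fromℕ< k<n
    B≡A+1 : toℕ B ≡ suc (toℕ A)
    B≡A+1 = trans (Finₚ.toℕ-fromℕ< j+1<n′) (cong suc (sym (Finₚ.toℕ-fromℕ< _)))
... | no k≮n = sym (trans (cong (app w) (swap-≢ (λ e → k≮n (subst (_< n) (sym (suc-injective e)) (<-trans (n<1+n j) j+1<n)))
                                                  (λ e → k≮n (subst (_< n) (sym (suc-injective e)) j+1<n))))
                          (app-out w (s≤s (≮⇒≥ k≮n))))

downTo : ℕ → ℕ → List ℕ
downTo a zero    = []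
downTo a (suc k) = (a + suc k) ∷ downTo a k

descending≡downTo : ∀ a k → descending a (a + k) ≡ downTo a k
descending≡downTo a k = trans (cong (λ m → map (a + k ∸_) (upTo m)) (m+n∸m≡n a k))
                              (trans (map-upTo (a + k ∸_) k) (go k (a + k ∸_) (λ _ → refl)))
  where
    go : ∀ k (f : ℕ → ℕ) → (∀ t → f t ≡ a + k ∸ t) → applyUpTo f k ≡ downTo a k
    go zero    f _  = refl
    go (suc k) f f≗ = cong₂ _∷_ (f≗ 0) (go k (f ∘ suc) (λ t → trans (f≗ (suc t)) (cong (_∸ suc t) (+-suc a k))))

-- the cycle (a+1 a+k+1 a+k ⋯ a+2) of ℕ
cycle : ℕ → ℕ → ℕ → ℕ
cycle a zero    r = r
cycle a (suc k) r = swap (a + suc k) (cycle a k r)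

app-·sList-downTo : ∀ {n} a k → a + k < n → ∀ (w : Permutation′ n) r →
                    app (w ·sList downTo a k) r ≡ app w (cycle a k r)
app-·sList-downTo a zero    _   w r = refl
app-·sList-downTo a (suc k) a+k<n w r =
  trans (app-·sList-downTo a k (≤-trans (s≤s (+-monoʳ-≤ a (n≤1+n k))) a+k<n) (w ·s (a + suc k)) r)
        (app-·s w (≤-trans (s≤s z≤n) (≤-reflexive (sym (+-suc a k)))) a+k<n (cycle a k r))

cycle-≤ : ∀ a k r → r ≤ a → cycle a k r ≡ r
cycle-≤ a zero    r r≤a = refl
cycle-≤ a (suc k) r r≤a rewrite cycle-≤ a k r r≤a =
  swap-≢ (λ e → <-irrefl e (≤-trans (s≤s r≤a) (≤-trans (s≤s (m≤m+n a k)) (≤-reflexive (sym (+-suc a k))))))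
         (λ e → <-irrefl e (≤-trans (s≤s r≤a) (s≤s (m≤m+n a (suc k)))))

cycle-> : ∀ a k r → suc (a + k) < r → cycle a k r ≡ r
cycle-> a zero    r _ = refl
cycle-> a (suc k) r a+k+1<r rewrite cycle-> a k r (<-trans (s≤s (+-monoʳ-< a (n<1+n k))) a+k+1<r) =
  swap-≢ (λ e → <-irrefl (sym e) (<-trans (n<1+n _) a+k+1<r)) (λ e → <-irrefl (sym e) a+k+1<r)

cycle-first : ∀ a k → cycle a k (suc a) ≡ suc (a + k)
cycle-first a zero    = cong suc (sym (+-identityʳ a))
cycle-first a (suc k) rewrite cycle-first a k = trans (cong (swap (a + suc k)) (sym (+-suc a k))) (swap-left (a + suc k))

cycle-shift : ∀ a k r → suc a ≤ r → r ≤ a + k → cycle a k (suc r) ≡ r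
cycle-shift a zero    r a<r r≤a+0 = ⊥-elim (<-irrefl refl (≤-trans a<r (≤-trans r≤a+0 (≤-reflexive (+-identityʳ a)))))
cycle-shift a (suc k) r a<r r≤ with r ≤? a + k
... | yes r≤a+k rewrite cycle-shift a k r a<r r≤a+k =
  swap-≢ (λ e → <-irrefl e (≤-trans (s≤s r≤a+k) (≤-reflexive (sym (+-suc a k)))))
         (λ e → <-irrefl e (≤-trans (s≤s r≤a+k) (≤-trans (≤-reflexive (sym (+-suc a k))) (n≤1+n _))))
... | no r≰a+k with ≤-antisym r≤ (≤-trans (≤-reflexive (+-suc a k)) (≰⇒> r≰a+k))
... | refl rewrite cycle-> a k (suc (a + suc k)) (s≤s (≤-reflexive (sym (+-suc a k)))) = swap-right (a + suc k)

cycle-suc : ∀ a k r → cycle a (suc k) r ≡ cycle (suc a) k (swap (suc a) r)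
cycle-suc a zero    r = cong (λ j → swap j r) (trans (+-suc a 0) (cong suc (+-identityʳ a)))
cycle-suc a (suc k) r = trans (cong (swap (a + suc (suc k))) (cycle-suc a k r))
                              (cong (λ j → swap j (cycle (suc a) k (swap (suc a) r))) (+-suc a (suc k)))

record InRothe {n} (w : Permutation′ n) (r c : ℕ) : Set where
  constructor inRothe
  field
    1≤r : 1 ≤ r
    r≤n : r ≤ n
    1≤c : 1 ≤ c
    c≤n : c ≤ n
    r<w⁻¹c : r < appInv w c
    c<wr : c < app w r

module _ {n} (w : Permutation′ n) where

  rothe-true⇒ : ∀ r c → rothe w r c ≡ true → InRothe w r c
  rothe-true⇒ r c e = inRothe (≤ᵇ≡true⇒≤ (∧-elimˡ e)) (≤ᵇ≡true⇒≤ (∧-elimˡ e₂)) (≤ᵇ≡true⇒≤ (∧-elimˡ e₃))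
                                  (≤ᵇ≡true⇒≤ (∧-elimˡ e₄)) (<ᵇ≡true⇒< (∧-elimˡ e₅)) (<ᵇ≡true⇒< (∧-elimʳ e₅))
    where
      e₂ = ∧-elimʳ {1 ≤ᵇ r} e
      e₃ = ∧-elimʳ {r ≤ᵇ n} e₂
      e₄ = ∧-elimʳ {1 ≤ᵇ c} e₃
      e₅ = ∧-elimʳ {c ≤ᵇ n} e₄

  InRothe⇒rothe-true : ∀ {r c} → InRothe w r c → rothe w r c ≡ true
  InRothe⇒rothe-true (inRothe 1≤r r≤n 1≤c c≤n r<w⁻¹c c<wr)
    rewrite ≤⇒≤ᵇ≡true 1≤r | ≤⇒≤ᵇ≡true r≤n | ≤⇒≤ᵇ≡true 1≤c | ≤⇒≤ᵇ≡true c≤n =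
    ∧-intro (<⇒<ᵇ≡true r<w⁻¹c) (<⇒<ᵇ≡true c<wr)

  ¬InRothe⇒rothe-false : ∀ r c → ¬ InRothe w r c → rothe w r c ≡ false
  ¬InRothe⇒rothe-false r c ∉ = ¬-not (∉ ∘ rothe-true⇒ r c)

  rothe-row-out : ∀ r c → ¬ (1 ≤ r × r ≤ n) → rothe w r c ≡ false
  rothe-row-out r c out = ¬InRothe⇒rothe-false r c (λ x → out (InRothe.1≤r x , InRothe.r≤n x))

  rothe-col-out : ∀ r c → ¬ (1 ≤ c × c ≤ n) → rothe w r c ≡ false
  rothe-col-out r c out = ¬InRothe⇒rothe-false r c (λ x → out (InRothe.1≤c x , InRothe.c≤n x))

colIs⇒ : ∀ n D c j → colIsᵇ n D c j ≡ true → ∀ r → 1 ≤ r → r ≤ n → D r c ≡ (r ≤ᵇ j)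
colIs⇒ n D c j e r 1≤r r≤n =
  ==⇒≡ (all-range⁻ (λ r → D r c == (r ≤ᵇ j)) 0 n (trans (cong (all _) (sym ([1,n]≡range n))) e) r (1≤r , r≤n))
  where
    ==⇒≡ : ∀ {x y} → (x == y) ≡ true → x ≡ y
    ==⇒≡ {true}  {true}  _ = refl
    ==⇒≡ {false} {false} _ = refl

⇒colIs : ∀ n D c j → (∀ r → 1 ≤ r → r ≤ n → D r c ≡ (r ≤ᵇ j)) → colIsᵇ n D c j ≡ true
⇒colIs n D c j f =
  trans (cong (all _) ([1,n]≡range n)) (all-range⁺ (λ r → D r c == (r ≤ᵇ j)) 0 n (λ r (0<r , r≤n) → ≡⇒== (f r 0<r r≤n)))
  where
    ≡⇒== : ∀ {x y} → x ≡ y → (x == y) ≡ true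
    ≡⇒== {true}  refl = refl
    ≡⇒== {false} refl = refl

colIs-noGap : ∀ n D c j → colIsᵇ n D c j ≡ true →
              ∀ r → 1 ≤ r → suc r ≤ n → D r c ≡ false → D (suc r) c ≡ true → ⊥
colIs-noGap n D c j e r 1≤r r<n r∉ r+1∈ =
  not-¬ (trans (sym (colIs⇒ n D c j e r 1≤r (≤-trans (n≤1+n r) r<n))) r∉)
        (≤⇒≤ᵇ≡true (≤-trans (n≤1+n r) (≤ᵇ≡true⇒≤ (trans (sym (colIs⇒ n D c j e (suc r) (s≤s z≤n) r<n)) r+1∈))))

colStd⇒colIs : ∀ n D c → colStdᵇ n D c ≡ true → ∃ λ j → colIsᵇ n D c j ≡ true
colStd⇒colIs n D c e with colIsᵇ n D c 0 in e₀
... | true  = 0 , e₀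
... | false with any-range⁻ (colIsᵇ n D c) 0 n (trans (cong (any _) (sym ([1,n]≡range n))) e)
... | j , _ , eⱼ = j , eⱼ

colIs-unique : ∀ n D c u t → u < n → (∀ r → 1 ≤ r → r ≤ n → D r c ≡ (r ≤ᵇ u)) → colIsᵇ n D c t ≡ (t ≡ᵇ u)
colIs-unique n D c u t u<n column≡[u] = true⇔true⇒≡ ⇒ (λ e → subst (λ t → colIsᵇ n D c t ≡ true) (sym (≡ᵇ≡true⇒≡ e)) (⇒colIs n D c u column≡[u]))
  where
    ⇒ : colIsᵇ n D c t ≡ true → (t ≡ᵇ u) ≡ true
    ⇒ e with <-cmp t u
    ... | tri≈ _ t≡u _ = ≡⇒≡ᵇ≡true t≡u
    ... | tri< t<u _ _ = ⊥-elim (not-¬ (≰⇒≤ᵇ≡false {suc t} {t} (<-irrefl refl))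
          (trans (sym (colIs⇒ n D c t e (suc t) (s≤s z≤n) (≤-trans t<u (<⇒≤ u<n))))
                 (trans (column≡[u] (suc t) (s≤s z≤n) (≤-trans t<u (<⇒≤ u<n))) (≤⇒≤ᵇ≡true t<u))))
    ... | tri> _ _ u<t = ⊥-elim (not-¬ (≰⇒≤ᵇ≡false {suc u} {u} (<-irrefl refl))
          (trans (sym (column≡[u] (suc u) (s≤s z≤n) u<n)) (trans (colIs⇒ n D c t e (suc u) (s≤s z≤n) u<n) (≤⇒≤ᵇ≡true u<t))))

colIs-≤ : ∀ n D c j t → colIsᵇ n D c j ≡ true → colIsᵇ n D c t ≡ true → 1 ≤ t → t ≤ n → t ≤ j
colIs-≤ n D c j t column≡[j] column≡[t] 1≤t t≤n =
  ≤ᵇ≡true⇒≤ (trans (sym (colIs⇒ n D c j column≡[j] t 1≤t t≤n)) (trans (colIs⇒ n D c t column≡[t] t 1≤t t≤n) (≤⇒≤ᵇ≡true {t} ≤-refl)))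

-- the condition under which emptyStdCols empties column c
nonemptyStdᵇ : ℕ → Diagram → ℕ → Bool
nonemptyStdᵇ n D c = any (colIsᵇ n D c) [1, n ]

nonemptyStd⁺ : ∀ n D c j → 1 ≤ j → j ≤ n → colIsᵇ n D c j ≡ true → nonemptyStdᵇ n D c ≡ true
nonemptyStd⁺ n D c j 1≤j j≤n e = trans (cong (any _) ([1,n]≡range n)) (any-range⁺ (colIsᵇ n D c) 0 n j (1≤j , j≤n) e)

nonemptyStd⁻ : ∀ n D c → nonemptyStdᵇ n D c ≡ true → ∃ λ j → (1 ≤ j × j ≤ n) × colIsᵇ n D c j ≡ true
nonemptyStd⁻ n D c e = any-range⁻ (colIsᵇ n D c) 0 n (trans (cong (any _) (sym ([1,n]≡range n))) e)

prefixᵇ : ℕ → ℕ → Bool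
prefixᵇ j r = (1 ≤ᵇ r) ∧ (r ≤ᵇ j)

_≐_ : Diagram → Diagram → Set
X ≐ Y = ∀ r c → X r c ≡ Y r c

colIs-cong : ∀ n X Y c c′ j → (∀ r → 1 ≤ r → r ≤ n → X r c ≡ Y r c′) → colIsᵇ n X c j ≡ colIsᵇ n Y c′ j
colIs-cong n X Y c c′ j f = true⇔true⇒≡
  (λ e → ⇒colIs n Y c′ j (λ r p q → trans (sym (f r p q)) (colIs⇒ n X c j e r p q)))
  (λ e → ⇒colIs n X c j (λ r p q → trans (f r p q) (colIs⇒ n Y c′ j e r p q)))

nonemptyStd-cong : ∀ n X Y c c′ → (∀ r → 1 ≤ r → r ≤ n → X r c ≡ Y r c′) → nonemptyStdᵇ n X c ≡ nonemptyStdᵇ n Y c′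
nonemptyStd-cong n X Y c c′ f = true⇔true⇒≡
  (λ e → let (j , (1≤j , j≤n) , eⱼ) = nonemptyStd⁻ n X c e
         in nonemptyStd⁺ n Y c′ j 1≤j j≤n (trans (sym (colIs-cong n X Y c c′ j f)) eⱼ))
  (λ e → let (j , (1≤j , j≤n) , eⱼ) = nonemptyStd⁻ n Y c′ e
         in nonemptyStd⁺ n X c j 1≤j j≤n (trans (colIs-cong n X Y c c′ j f) eⱼ))

colIs-≐ : ∀ n {X Y} c j → X ≐ Y → colIsᵇ n X c j ≡ colIsᵇ n Y c j
colIs-≐ n {X} {Y} c j X≐Y = colIs-cong n X Y c c j (λ r _ _ → X≐Y r c)

swapRows-≐ : ∀ i {X Y} → X ≐ Y → swapRows i X ≐ swapRows i Y
swapRows-≐ i {X} {Y} X≐Y r c = trans (swapRows≡swap i X r c) (trans (X≐Y (swap i r) c) (sym (swapRows≡swap i Y r c)))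

emptyColsEq-≐ : ∀ n i {X Y} → X ≐ Y → emptyColsEq n X i ≐ emptyColsEq n Y i
emptyColsEq-≐ n i X≐Y r c = cong₂ (λ u v → if u then false else v) (colIs-≐ n c i X≐Y) (X≐Y r c)

countCols-≐ : ∀ n {X Y} j → X ≐ Y → countCols n X j ≡ countCols n Y j
countCols-≐ n j X≐Y = trans (cong (count _) ([1,n]≡range n))
  (trans (count-range-cong _ _ 0 n (λ c _ → colIs-≐ n c j X≐Y)) (cong (count _) (sym ([1,n]≡range n))))

≐-sym : ∀ {X Y} → X ≐ Y → Y ≐ X
≐-sym X≐Y r c = sym (X≐Y r c)

OrthoLoop-≐ : ∀ n {X Y is ms} → X ≐ Y → OrthoLoop n X is ms → OrthoLoop n Y is ms
OrthoLoop-≐ n X≐Y (done empty) = done (λ c p q → trans (colIs-≐ n c 0 (≐-sym X≐Y)) (empty c p q))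
OrthoLoop-≐ n {X} {Y} {i ∷ is} {_ ∷ ms} X≐Y (step {c = c} (1≤c , c≤n , nonempty , leftmost) ((1≤i , i∉ , i+1∈) , smallest) rest) =
  subst (λ m → OrthoLoop n Y (i ∷ is) (m ∷ ms)) (countCols-≐ n i (swapRows-≐ i Y≐X))
    (step (1≤c , c≤n , trans (colIs-≐ n c 0 Y≐X) nonempty , (λ c′ p q → trans (colIs-≐ n c′ 0 Y≐X) (leftmost c′ p q)))
          ((1≤i , trans (Y≐X i c) i∉ , trans (Y≐X (suc i) c) i+1∈) ,
           (λ i′ i′<i (1≤i′ , i′∉ , i′+1∈) → smallest i′ i′<i (1≤i′ , trans (X≐Y i′ c) i′∉ , trans (X≐Y (suc i′) c) i′+1∈)))
          (OrthoLoop-≐ n (emptyColsEq-≐ n i (swapRows-≐ i X≐Y)) rest))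
  where
    Y≐X = ≐-sym X≐Y

LeftmostNonempty-unique : ∀ n X {c c′} → LeftmostNonempty n X c → LeftmostNonempty n X c′ → c ≡ c′
LeftmostNonempty-unique n X {c} {c′} (1≤c , _ , ne , lm) (1≤c′ , _ , ne′ , lm′) with <-cmp c c′
... | tri≈ _ c≡c′ _ = c≡c′
... | tri< c<c′ _ _ = ⊥-elim (not-¬ ne (lm′ c 1≤c c<c′))
... | tri> _ _ c′<c = ⊥-elim (not-¬ ne′ (lm c′ 1≤c′ c′<c))

SmallestMissingTooth-unique : ∀ X c {i i′} → SmallestMissingTooth X c i → SmallestMissingTooth X c i′ → i ≡ i′
SmallestMissingTooth-unique X c {i} {i′} (tooth , smallest) (tooth′ , smallest′) with <-cmp i i′
... | tri≈ _ i≡i′ _ = i≡i′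
... | tri< i<i′ _ _ = ⊥-elim (smallest′ i i<i′ tooth)
... | tri> _ _ i′<i = ⊥-elim (smallest i′ i′<i tooth′)

data Around (a b : ℕ) : ℕ → Set where
  left  : ∀ {x} → x ≤ a → Around a b x
  block : ∀ {x} → suc a ≤ x → x ≤ b → Around a b x
  edge  : ∀ {x} → x ≡ suc b → Around a b x
  right : ∀ {x} → suc b < x → Around a b x

around : ∀ a b x → Around a b x
around a b x with x ≤? a
... | yes x≤a = left x≤a
... | no  x≰a with x ≤? b
... | yes x≤b = block (≰⇒> x≰a) x≤b
... | no  x≰b with x ≟ suc b
... | yes x≡b+1 = edge x≡b+1
... | no  x≢b+1 = right (≤∧≢⇒< (≰⇒> x≰b) (x≢b+1 ∘ sym))

-- how cycle a k moves r, for b = a + k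
data AroundCycle (a b : ℕ) : ℕ → Set where
  fixedˡ  : ∀ {r} → r ≤ a → AroundCycle a b r
  first   : AroundCycle a b (suc a)
  shifted : ∀ {r} → suc a ≤ r → r ≤ b → AroundCycle a b (suc r)
  fixedʳ  : ∀ {r} → suc b < r → AroundCycle a b r

aroundCycle : ∀ a b r → AroundCycle a b r
aroundCycle a b r with r ≤? a
... | yes r≤a = fixedˡ r≤a
... | no  r≰a with r ≟ suc a
... | yes refl = first
... | no  r≢a+1 with r ≤? suc b
aroundCycle a b zero    | no r≰a | no _ | yes _ = ⊥-elim (r≰a z≤n)
aroundCycle a b (suc r) | no r≰a | no r≢a+1 | yes r≤b+1 =
  shifted (≤∧≢⇒< (s≤s⁻¹ (≰⇒> r≰a)) (r≢a+1 ∘ cong suc ∘ sym)) (s≤s⁻¹ r≤b+1)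
... | no r≰b+1 = fixedʳ (≰⇒> r≰b+1)

data ColumnView (L h : ℕ) : ℕ → Set where
  low  : ∀ {c} → c ≤ L → ColumnView L h c
  top  : ∀ {c} → L < c → c ≤ h → ColumnView L h c
  high : ∀ {c} → h < c → ColumnView L h c

columnView : ∀ L h c → ColumnView L h c
columnView L h c with c ≤? L
... | yes c≤L = low c≤L
... | no  c≰L with c ≤? h
... | yes c≤h = top (≰⇒> c≰L) c≤h
... | no  c≰h = high (≰⇒> c≰h)

newK-correct : ∀ n (K K′ : ℕ → ℕ) a β m → (∀ t → 1 ≤ t → t ≢ a → t ≢ suc a → K′ t ≡ K t) →
               K a ≡ K′ a + β → K′ (suc a) ≡ β + m → map K′ [1, n ] ≡ newK n (map K [1, n ]) a β m
newK-correct n K K′ zero β m others _ K′[1] rewrite [1,n]≡range n = map-range-cong _ _ 0 n entry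
  where
    entry : ∀ j → InRange 0 n j → K′ j ≡ (if j ≡ᵇ 1 then β + m else at (map K (range 0 n)) j)
    entry j (1≤j , j≤n) with j ≟ 1
    ... | yes refl = K′[1]
    ... | no  j≢1 rewrite ≢⇒≡ᵇ≡false j≢1 =
          trans (others j 1≤j (λ j≡0 → <-irrefl (sym j≡0) 1≤j) j≢1) (sym (at-map-range K 0 n j 1≤j j≤n))
newK-correct n K K′ (suc a) β m others K[a] K′[a+1] rewrite [1,n]≡range n = map-range-cong _ _ 0 n entry
  where
    entry : ∀ j → InRange 0 n j → K′ j ≡ (if j ≡ᵇ suc a then at (map K (range 0 n)) (suc a) ∸ β
                                           else if j ≡ᵇ suc (suc a) then β + m else at (map K (range 0 n)) j)
    entry j (1≤j , j≤n) with j ≟ suc a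
    ... | yes refl rewrite ≡⇒≡ᵇ≡true {j} refl =
          trans (sym (m+n∸n≡m (K′ (suc a)) β)) (cong (_∸ β) (trans (sym K[a]) (sym (at-map-range K 0 n (suc a) 1≤j j≤n))))
    ... | no  j≢a rewrite ≢⇒≡ᵇ≡false j≢a with j ≟ suc (suc a)
    ... | yes refl rewrite ≡⇒≡ᵇ≡true {j} refl = K′[a+1]
    ... | no  j≢a+1 rewrite ≢⇒≡ᵇ≡false j≢a+1 = trans (others j 1≤j j≢a j≢a+1) (sym (at-map-range K 0 n j 1≤j j≤n))

Conclusion : ∀ {n} (w : Permutation′ n) (is ks ms : List ℕ) (α i₁ β : ℕ) → Set
Conclusion {n} w is ks ms α i₁ β =
  (∀ j → 1 ≤ j → j ≤ β → is ! j ≡ just (suc (i₁ ∸ j))) ×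
  (1 ≤ α → at ks α ≥ β) ×
  (∀ j → suc α ≤ j → j ≤ i₁ → ks ! j ≡ just 0) ×
  (∀ j → 1 ≤ j → j ≤ β ∸ 1 → ms ! j ≡ just 0) ×
  (∃ λ mβ → ms ! β ≡ just mβ ×
    Orthodontic (w ·sList descending α i₁) (drop β is) (newK n ks α β mβ) (drop β ms))

-- Column h+1 = C of D(w) is the first nonstandard one, [a] ⊆ C, the block [a+1, b] misses C,
-- b+1 ∈ C, and w is increasing on the block; in the paper's notation a = α, b = i₁, β = k+1.

module PrimaryColumn {n : ℕ} (w : Permutation′ n) (h a k : ℕ)
  (h<n : h < n)
  (standard≤h : ∀ c → 1 ≤ c → c ≤ h → colStdᵇ n (rothe w) c ≡ true)
  (nonstandard : colStdᵇ n (rothe w) (suc h) ≡ false)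
  ([a]⊆C : ∀ r → 1 ≤ r → r ≤ a → rothe w r (suc h) ≡ true)
  (block∉C : ∀ r → suc a ≤ r → r ≤ a + suc k → rothe w r (suc h) ≡ false)
  (b+1∈C : rothe w (suc (a + suc k)) (suc h) ≡ true)
  (increasing : SortedOn w a (a + suc k))
  where

  b : ℕ
  b = a + suc k

  D : Diagram
  D = rothe w

  Block : ℕ → Set
  Block r = suc a ≤ r × r ≤ b

  a<b : a < b
  a<b = ≤-trans (s≤s (m≤m+n a k)) (≤-reflexive (sym (+-suc a k)))

  b+1∈D : InRothe w (suc b) (suc h)
  b+1∈D = rothe-true⇒ w (suc b) (suc h) b+1∈C

  b<n : b < n
  b<n = InRothe.r≤n b+1∈D

  a<n : a < n
  a<n = <-trans a<b b<n

  ≤b⇒≤n : ∀ {r} → r ≤ b → r ≤ n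
  ≤b⇒≤n r≤b = ≤-trans r≤b (<⇒≤ b<n)

  a<⇒1≤ : ∀ {r} → suc a ≤ r → 1 ≤ r
  a<⇒1≤ = ≤-trans (s≤s z≤n)

  b+1<w⁻¹[h+1] : suc b < appInv w (suc h)
  b+1<w⁻¹[h+1] = InRothe.r<w⁻¹c b+1∈D

  h+1<w[b+1] : suc h < app w (suc b)
  h+1<w[b+1] = InRothe.c<wr b+1∈D

  h+1<w[≤a] : ∀ r → 1 ≤ r → r ≤ a → suc h < app w r
  h+1<w[≤a] r 1≤r r≤a = InRothe.c<wr (rothe-true⇒ w r (suc h) ([a]⊆C r 1≤r r≤a))

  w[block]≤h : ∀ r → Block r → app w r ≤ h
  w[block]≤h r (a<r , r≤b) with app w r ≤? h
  ... | yes wr≤h = wr≤h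
  ... | no  wr≰h = ⊥-elim (not-¬ (block∉C r a<r r≤b)
      (InRothe⇒rothe-true w (inRothe (a<⇒1≤ a<r) (≤b⇒≤n r≤b) (s≤s z≤n) h<n r<w⁻¹[h+1] h+1<wr)))
    where
      r<w⁻¹[h+1] : r < appInv w (suc h)
      r<w⁻¹[h+1] = ≤-trans (s≤s r≤b) (≤-trans (n≤1+n _) b+1<w⁻¹[h+1])
      h+1<wr : suc h < app w r
      h+1<wr = ≤∧≢⇒< (≰⇒> wr≰h) λ h+1≡wr →
        <-irrefl (sym (app≡⇒appInv≡ w (a<⇒1≤ a<r) (≤b⇒≤n r≤b) (sym h+1≡wr))) r<w⁻¹[h+1]

  unused⇒b+1<w⁻¹ : ∀ c → 1 ≤ c → c ≤ h → (∀ r → Block r → app w r ≢ c) → suc b < appInv w c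
  unused⇒b+1<w⁻¹ c 1≤c c≤h unused =
    b+1<preimage (appInv w c) (proj₁ (appInv-range w 1≤c c≤n)) (app-appInv w 1≤c c≤n)
    where
      c≤n = ≤-trans c≤h (<⇒≤ h<n)
      b+1<preimage : ∀ x → 1 ≤ x → app w x ≡ c → suc b < x
      b+1<preimage x 1≤x wx≡c with around a b x
      ... | left x≤a        = ⊥-elim (<-irrefl (sym wx≡c) (<-trans (s≤s c≤h) (h+1<w[≤a] x 1≤x x≤a)))
      ... | block a<x x≤b   = ⊥-elim (unused x (a<x , x≤b) wx≡c)
      ... | edge refl       = ⊥-elim (<-irrefl (sym wx≡c) (<-trans (s≤s c≤h) h+1<w[b+1]))
      ... | right b+1<x     = b+1<x

  w-increasing : ∀ r r′ → suc a ≤ r → r < r′ → r′ ≤ b → app w r < app w r′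
  w-increasing r (suc r′) a<r (s≤s r≤r′) r′<b with m≤n⇒m<n∨m≡n r≤r′
  ... | inj₂ refl = increasing r a<r r′<b
  ... | inj₁ r<r′ = <-trans (w-increasing r r′ a<r r<r′ (≤-trans (n≤1+n r′) r′<b))
                            (increasing r′ (≤-trans a<r (<⇒≤ r<r′)) r′<b)

  w-monotone : ∀ r r′ → suc a ≤ r → r ≤ r′ → r′ ≤ b → app w r ≤ app w r′
  w-monotone r r′ a<r r≤r′ r′≤b with m≤n⇒m<n∨m≡n r≤r′
  ... | inj₂ refl = ≤-refl
  ... | inj₁ r<r′ = <⇒≤ (w-increasing r r′ a<r r<r′ r′≤b)

  -- Since columns ≤ h are standard intervals, w cannot skip a value ≤ h between r and r+1:
  -- column c would contain row r+1 but not row r.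
  no-value-skipped : ∀ r c → Block r → 1 ≤ c → c ≤ h → app w r < c → c < app w (suc r) → ⊥
  no-value-skipped r c (a<r , r≤b) 1≤c c≤h wr<c c<wr+1 with colStd⇒colIs n D c (standard≤h c 1≤c c≤h)
  ... | j , column≡[j] = colIs-noGap n D c j column≡[j] r (a<⇒1≤ a<r) (≤-trans (s≤s r≤b) b<n) r∉ r+1∈
    where
      unused : ∀ r′ → Block r′ → app w r′ ≢ c
      unused r′ (a<r′ , r′≤b) wr′≡c with r′ ≤? r
      ... | yes r′≤r = <-irrefl wr′≡c (≤-<-trans (w-monotone r′ r a<r′ r′≤r r≤b) wr<c)
      ... | no  r′≰r = <-irrefl (sym wr′≡c) (<-≤-trans c<wr+1 (w-monotone (suc r) r′ (≤-trans a<r (n≤1+n r)) (≰⇒> r′≰r) r′≤b))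
      r∉ : D r c ≡ false
      r∉ = ¬InRothe⇒rothe-false w r c (λ r∈ → <-irrefl refl (<-trans wr<c (InRothe.c<wr r∈)))
      r+1∈ : D (suc r) c ≡ true
      r+1∈ = InRothe⇒rothe-true w (inRothe (s≤s z≤n) (≤-trans (s≤s r≤b) b<n) 1≤c (≤-trans c≤h (<⇒≤ h<n))
               (≤-trans (s≤s (s≤s r≤b)) (unused⇒b+1<w⁻¹ c 1≤c c≤h unused)) c<wr+1)

  w[b]≡h : app w b ≡ h
  w[b]≡h with m≤n⇒m<n∨m≡n (w[block]≤h b (a<b , ≤-refl))
  ... | inj₂ wb≡h = wb≡h
  ... | inj₁ wb<h = ⊥-elim (no-value-skipped b h (a<b , ≤-refl) 1≤h ≤-refl wb<h (<-trans (n<1+n h) h+1<w[b+1]))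
    where 1≤h = ≤-trans (proj₁ (app-range w (a<⇒1≤ a<b) (≤b⇒≤n ≤-refl))) (<⇒≤ wb<h)

  w-consecutive : ∀ r → suc a ≤ r → suc r ≤ b → app w (suc r) ≡ suc (app w r)
  w-consecutive r a<r r<b with m≤n⇒m<n∨m≡n (increasing r a<r r<b)
  ... | inj₂ wr+1≡ = sym wr+1≡
  ... | inj₁ gap = ⊥-elim (no-value-skipped r c (a<r , ≤-trans (n≤1+n r) r<b)
                            (≤-trans (s≤s z≤n) wr<c) c≤h wr<c c<wr+1)
    where
      c = pred (app w (suc r))
      c<wr+1 : c < app w (suc r)
      c<wr+1 = ≤-reflexive (suc-pred (app w (suc r)) {{>-nonZero (≤-trans (s≤s z≤n) gap)}})
      wr<c : app w r < c
      wr<c = s≤s⁻¹ (≤-trans gap (≤-reflexive (sym (suc-pred (app w (suc r)) {{>-nonZero (≤-trans (s≤s z≤n) gap)}}))))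
      c≤h : c ≤ h
      c≤h = <⇒≤ (<-≤-trans c<wr+1 (w[block]≤h (suc r) (≤-trans a<r (n≤1+n r) , r<b)))

  -- w maps the block onto (L, h]
  L : ℕ
  L = pred (app w (suc a))

  w[a+1]≡L+1 : app w (suc a) ≡ suc L
  w[a+1]≡L+1 = sym (suc-pred (app w (suc a)) {{>-nonZero (proj₁ (app-range w (s≤s z≤n) (≤b⇒≤n a<b)))}})

  w[a+1+d] : ∀ d → d + suc a ≤ b → app w (d + suc a) ≡ suc (L + d)
  w[a+1+d] zero    _ = trans w[a+1]≡L+1 (cong suc (sym (+-identityʳ L)))
  w[a+1+d] (suc d) ≤b = begin
    app w (suc (d + suc a))   ≡⟨ w-consecutive (d + suc a) (m≤n+m (suc a) d) ≤b ⟩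
    suc (app w (d + suc a))   ≡⟨ cong suc (w[a+1+d] d (≤-trans (n≤1+n _) ≤b)) ⟩
    suc (suc (L + d))         ≡⟨ cong suc (sym (+-suc L d)) ⟩
    suc (L + suc d)           ∎
    where open ≡-Reasoning

  k+a+1≡b : k + suc a ≡ b
  k+a+1≡b = trans (+-suc k a) (trans (cong suc (+-comm k a)) (sym (+-suc a k)))

  L+β≡h : L + suc k ≡ h
  L+β≡h = trans (+-suc L k) (trans (sym (w[a+1+d] k (≤-reflexive k+a+1≡b))) (trans (cong (app w) k+a+1≡b) w[b]≡h))

  L<h : L < h
  L<h = ≤-trans (s≤s (m≤m+n L k)) (≤-trans (≤-reflexive (sym (+-suc L k))) (≤-reflexive L+β≡h))

  Top : ℕ → Set
  Top c = L < c × c ≤ h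

  w[block]∈Top : ∀ r → Block r → Top (app w r)
  w[block]∈Top r (a<r , r≤b) =
    ≤-trans (≤-reflexive (sym w[a+1]≡L+1)) (w-monotone (suc a) r ≤-refl a<r r≤b) , w[block]≤h r (a<r , r≤b)

  w⁻¹[Top]∈Block : ∀ c → Top c → Block (appInv w c)
  w⁻¹[Top]∈Block c (L<c , c≤h) = subst Block (sym w⁻¹c≡x) (m≤n+m (suc a) d , x≤b)
    where
      d = c ∸ suc L
      x = d + suc a
      d≤k : d ≤ k
      d≤k = ≤-trans (∸-monoˡ-≤ (suc L) (≤-trans c≤h (≤-reflexive (sym L+β≡h))))
                    (≤-reflexive (trans (cong (_∸ suc L) (+-suc L k)) (m+n∸m≡n L k)))
      x≤b : x ≤ b
      x≤b = ≤-trans (+-monoˡ-≤ (suc a) d≤k) (≤-reflexive k+a+1≡b)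
      w⁻¹c≡x : appInv w c ≡ x
      w⁻¹c≡x = app≡⇒appInv≡ w (a<⇒1≤ (m≤n+m (suc a) d)) (≤b⇒≤n x≤b) (trans (w[a+1+d] d x≤b) (m+[n∸m]≡n L<c))

  top-column : ∀ c → Top c → ∀ r → D r c ≡ prefixᵇ a r
  top-column c (L<c , c≤h) r = true⇔true⇒≡ ⇒prefix prefix⇒
    where
      1≤c = ≤-trans (s≤s z≤n) L<c
      c≤n = ≤-trans c≤h (<⇒≤ h<n)
      x = appInv w c
      x∈Block = w⁻¹[Top]∈Block c (L<c , c≤h)
      ⇒prefix : D r c ≡ true → prefixᵇ a r ≡ true
      ⇒prefix r∈ with rothe-true⇒ w r c r∈ | r ≤? a
      ... | inRothe 1≤r _ _ _ _ _    | yes r≤a = ∧-intro (≤⇒≤ᵇ≡true 1≤r) (≤⇒≤ᵇ≡true r≤a)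
      ... | inRothe _ _ _ _ r<x c<wr | no  r≰a = ⊥-elim (<-irrefl refl
            (<-trans c<wr (<-≤-trans (w-increasing r x (≰⇒> r≰a) r<x (proj₂ x∈Block)) (≤-reflexive (app-appInv w 1≤c c≤n)))))
      prefix⇒ : prefixᵇ a r ≡ true → D r c ≡ true
      prefix⇒ e = InRothe⇒rothe-true w (inRothe 1≤r (≤-trans r≤a (<⇒≤ a<n)) 1≤c c≤n
                    (≤-trans (s≤s r≤a) (proj₁ x∈Block)) (<-trans (s≤s c≤h) (h+1<w[≤a] r 1≤r r≤a)))
        where
          1≤r = ≤ᵇ≡true⇒≤ (∧-elimˡ e)
          r≤a = ≤ᵇ≡true⇒≤ (∧-elimʳ {1 ≤ᵇ r} e)

  low-column : ∀ c → 1 ≤ c → c ≤ L → ∀ r → suc a ≤ r → r ≤ suc b → D r c ≡ true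
  low-column c 1≤c c≤L r a<r r≤b+1 =
    InRothe⇒rothe-true w (inRothe (a<⇒1≤ a<r) (≤-trans r≤b+1 b<n) 1≤c (≤-trans c≤L (≤-trans (<⇒≤ L<h) (<⇒≤ h<n)))
                                  (≤-<-trans r≤b+1 b+1<w⁻¹c) c<wr)
    where
      b+1<w⁻¹c = unused⇒b+1<w⁻¹ c 1≤c (≤-trans c≤L (<⇒≤ L<h))
                   (λ r′ r′∈ wr′≡c → <-irrefl (sym wr′≡c) (≤-<-trans c≤L (proj₁ (w[block]∈Top r′ r′∈))))
      c<wr : c < app w r
      c<wr with m≤n⇒m<n∨m≡n r≤b+1
      ... | inj₂ refl = <-trans (≤-trans (s≤s c≤L) (≤-trans L<h (n≤1+n h))) h+1<w[b+1]
      ... | inj₁ r<b+1 = ≤-<-trans c≤L (proj₁ (w[block]∈Top r (a<r , s≤s⁻¹ r<b+1)))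

  high-column : ∀ c → h < c → ∀ r → Block r → D r c ≡ false
  high-column c h<c r r∈ = ¬InRothe⇒rothe-false w r c
    (λ r∈D → <-irrefl refl (≤-trans (InRothe.c<wr r∈D) (≤-trans (w[block]≤h r r∈) (<⇒≤ h<c))))

  -- The new permutation w′ = w s_b s_{b-1} ⋯ s_{a+1} = w ∘ σ

  σ : ℕ → ℕ
  σ = cycle a (suc k)

  w′ : Permutation′ n
  w′ = w ·sList descending a b

  app-w′ : ∀ r → app w′ r ≡ app w (σ r)
  app-w′ r = trans (cong (λ js → app (w ·sList js) r) (descending≡downTo a (suc k))) (app-·sList-downTo a (suc k) b<n w r)

  σ-range : ∀ r → 1 ≤ r → r ≤ n → 1 ≤ σ r × σ r ≤ n
  σ-range r 1≤r r≤n with aroundCycle a b r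
  ... | fixedˡ r≤a rewrite cycle-≤ a (suc k) r r≤a = 1≤r , r≤n
  ... | first rewrite cycle-first a (suc k) = s≤s z≤n , b<n
  ... | shifted {r₀} a<r₀ r₀≤b rewrite cycle-shift a (suc k) r₀ a<r₀ r₀≤b = a<⇒1≤ a<r₀ , ≤b⇒≤n r₀≤b
  ... | fixedʳ b+1<r rewrite cycle-> a (suc k) r b+1<r = 1≤r , r≤n

  σ-out : ∀ r → ¬ (1 ≤ r × r ≤ n) → σ r ≡ r
  σ-out zero    _   = cycle-≤ a (suc k) zero z≤n
  σ-out (suc r) out with suc r ≤? n
  ... | yes r<n = ⊥-elim (out (s≤s z≤n , r<n))
  ... | no  r≮n = cycle-> a (suc k) (suc r) (≤-trans (s≤s b<n) (≰⇒> r≮n))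

  module _ (c : ℕ) (1≤c : 1 ≤ c) (c≤n : c ≤ n) where

    private
      x = appInv w c
      1≤x = proj₁ (appInv-range w 1≤c c≤n)
      x≤n = proj₂ (appInv-range w 1≤c c≤n)

      preimage : ∀ y → 1 ≤ y → y ≤ n → σ y ≡ x → appInv w′ c ≡ y
      preimage y 1≤y y≤n σy≡x = app≡⇒appInv≡ w′ 1≤y y≤n (trans (app-w′ y) (trans (cong (app w) σy≡x) (app-appInv w 1≤c c≤n)))

    w′⁻¹-left : x ≤ a → appInv w′ c ≡ x
    w′⁻¹-left x≤a = preimage x 1≤x x≤n (cycle-≤ a (suc k) x x≤a)

    w′⁻¹-block : Block x → appInv w′ c ≡ suc x
    w′⁻¹-block (a<x , x≤b) = preimage (suc x) (s≤s z≤n) (≤-trans (s≤s x≤b) b<n) (cycle-shift a (suc k) x a<x x≤b)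

    w′⁻¹-edge : x ≡ suc b → appInv w′ c ≡ suc a
    w′⁻¹-edge x≡b+1 = preimage (suc a) (s≤s z≤n) (≤-trans (s≤s (<⇒≤ a<b)) b<n) (trans (cycle-first a (suc k)) (sym x≡b+1))

    w′⁻¹-right : suc b < x → appInv w′ c ≡ x
    w′⁻¹-right b+1<x = preimage x 1≤x x≤n (cycle-> a (suc k) x b+1<x)

  -- Outside (L, h], w′ and w ∘ σ have the same inversions in column c: comparing a row r
  -- with w′⁻¹(c) is comparing σ(r) with w⁻¹(c).
  module _ (c : ℕ) (1≤c : 1 ≤ c) (c≤n : c ≤ n) (r : ℕ) where

    private
      x = appInv w c

    compare-left : x ≤ a → (r < appInv w′ c → σ r < x) × (σ r < x → r < appInv w′ c)
    compare-left x≤a rewrite w′⁻¹-left c 1≤c c≤n x≤a = ⇒ , ⇐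
      where
        ⇒ : r < x → σ r < x
        ⇒ r<x rewrite cycle-≤ a (suc k) r (≤-trans (<⇒≤ r<x) x≤a) = r<x
        ⇐ : σ r < x → r < x
        ⇐ σr<x with aroundCycle a b r
        ... | fixedˡ r≤a rewrite cycle-≤ a (suc k) r r≤a = σr<x
        ... | first rewrite cycle-first a (suc k) = ⊥-elim (<-asym σr<x (≤-trans (s≤s x≤a) (<⇒≤ (s≤s a<b))))
        ... | shifted {r₀} a<r₀ r₀≤b rewrite cycle-shift a (suc k) r₀ a<r₀ r₀≤b = ⊥-elim (<-asym σr<x (≤-trans (s≤s x≤a) a<r₀))
        ... | fixedʳ b+1<r rewrite cycle-> a (suc k) r b+1<r = σr<x

    compare-edge : x ≡ suc b → c < app w (σ r) → (r < appInv w′ c → σ r < x) × (σ r < x → r < appInv w′ c)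
    compare-edge x≡b+1 c<wσr rewrite w′⁻¹-edge c 1≤c c≤n x≡b+1 | x≡b+1 = ⇒ , ⇐
      where
        ⇒ : r < suc a → σ r < suc b
        ⇒ (s≤s r≤a) rewrite cycle-≤ a (suc k) r r≤a = s≤s (≤-trans r≤a (<⇒≤ a<b))
        ⇐ : σ r < suc b → r < suc a
        ⇐ σr<b+1 with aroundCycle a b r
        ... | fixedˡ r≤a = s≤s r≤a
        ... | first rewrite cycle-first a (suc k) = ⊥-elim (<-irrefl refl σr<b+1)
        ... | shifted {r₀} a<r₀ r₀≤b rewrite cycle-shift a (suc k) r₀ a<r₀ r₀≤b = ⊥-elim (<-asym c<wσr c<w[r₀])
          where
            c<w[r₀] : app w r₀ < c
            c<w[r₀] = ≤-<-trans (w[block]≤h r₀ (a<r₀ , r₀≤b))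
                        (<-≤-trans (<-trans (n<1+n h) h+1<w[b+1])
                                   (≤-reflexive (trans (cong (app w) (sym x≡b+1)) (app-appInv w 1≤c c≤n))))
        ... | fixedʳ b+1<r rewrite cycle-> a (suc k) r b+1<r = ⊥-elim (<-asym σr<b+1 b+1<r)

    compare-right : suc b < x → (r < appInv w′ c → σ r < x) × (σ r < x → r < appInv w′ c)
    compare-right b+1<x rewrite w′⁻¹-right c 1≤c c≤n b+1<x = ⇒ , ⇐
      where
        ⇒ : r < x → σ r < x
        ⇒ r<x with aroundCycle a b r
        ... | fixedˡ r≤a rewrite cycle-≤ a (suc k) r r≤a = r<x
        ... | first rewrite cycle-first a (suc k) = b+1<x
        ... | shifted {r₀} a<r₀ r₀≤b rewrite cycle-shift a (suc k) r₀ a<r₀ r₀≤b = <-trans (n<1+n r₀) r<x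
        ... | fixedʳ b+1<r rewrite cycle-> a (suc k) r b+1<r = r<x
        ⇐ : σ r < x → r < x
        ⇐ σr<x with aroundCycle a b r
        ... | fixedˡ r≤a rewrite cycle-≤ a (suc k) r r≤a = σr<x
        ... | first = <-trans (s≤s a<b) b+1<x
        ... | shifted a<r₀ r₀≤b = ≤-<-trans (s≤s r₀≤b) b+1<x
        ... | fixedʳ b+1<r rewrite cycle-> a (suc k) r b+1<r = σr<x

  w′-column : ∀ c → ¬ Top c → ∀ r → rothe w′ r c ≡ D (σ r) c
  w′-column c ¬top r with 1 ≤? c | c ≤? n
  ... | no 1≰c | _ = trans (rothe-col-out w′ r c (1≰c ∘ proj₁)) (sym (rothe-col-out w (σ r) c (1≰c ∘ proj₁)))
  ... | yes _ | no c≰n = trans (rothe-col-out w′ r c (c≰n ∘ proj₂)) (sym (rothe-col-out w (σ r) c (c≰n ∘ proj₂)))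
  ... | yes 1≤c | yes c≤n with 1 ≤? r | r ≤? n
  ... | no 1≰r | _ rewrite σ-out r (1≰r ∘ proj₁) = trans (rothe-row-out w′ r c (1≰r ∘ proj₁)) (sym (rothe-row-out w r c (1≰r ∘ proj₁)))
  ... | yes _ | no r≰n rewrite σ-out r (r≰n ∘ proj₂) = trans (rothe-row-out w′ r c (r≰n ∘ proj₂)) (sym (rothe-row-out w r c (r≰n ∘ proj₂)))
  ... | yes 1≤r | yes r≤n = true⇔true⇒≡ ⇒ ⇐
    where
      order-agrees : c < app w (σ r) → (r < appInv w′ c → σ r < appInv w c) × (σ r < appInv w c → r < appInv w′ c)
      order-agrees c<wσr with around a b (appInv w c)
      ... | left x≤a        = compare-left c 1≤c c≤n r x≤a
      ... | block a<x x≤b   = ⊥-elim (¬top (subst Top (app-appInv w 1≤c c≤n) (w[block]∈Top _ (a<x , x≤b))))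
      ... | edge x≡b+1      = compare-edge c 1≤c c≤n r x≡b+1 c<wσr
      ... | right b+1<x     = compare-right c 1≤c c≤n r b+1<x
      σr∈ = σ-range r 1≤r r≤n
      ⇒ : rothe w′ r c ≡ true → D (σ r) c ≡ true
      ⇒ e with rothe-true⇒ w′ r c e
      ... | inRothe _ _ _ _ r<w′⁻¹c c<w′r = InRothe⇒rothe-true w
            (inRothe (proj₁ σr∈) (proj₂ σr∈) 1≤c c≤n (proj₁ (order-agrees c<wσr) r<w′⁻¹c) c<wσr)
        where c<wσr = subst (c <_) (app-w′ r) c<w′r
      ⇐ : D (σ r) c ≡ true → rothe w′ r c ≡ true
      ⇐ e with rothe-true⇒ w (σ r) c e
      ... | inRothe _ _ _ _ σr<w⁻¹c c<wσr = InRothe⇒rothe-true w′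
            (inRothe 1≤r r≤n 1≤c c≤n (proj₂ (order-agrees c<wσr) σr<w⁻¹c) (subst (c <_) (sym (app-w′ r)) c<wσr))

  w′-top-column : ∀ c → Top c → ∀ r → rothe w′ r c ≡ prefixᵇ (suc a) r
  w′-top-column c (L<c , c≤h) r = true⇔true⇒≡ ⇒ ⇐
    where
      1≤c = ≤-trans (s≤s z≤n) L<c
      c≤n = ≤-trans c≤h (<⇒≤ h<n)
      x∈Block = w⁻¹[Top]∈Block c (L<c , c≤h)
      w′⁻¹c≡ : appInv w′ c ≡ suc (appInv w c)
      w′⁻¹c≡ = w′⁻¹-block c 1≤c c≤n x∈Block
      ⇒ : rothe w′ r c ≡ true → prefixᵇ (suc a) r ≡ true
      ⇒ e with rothe-true⇒ w′ r c e | aroundCycle a b r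
      ... | inRothe 1≤r _ _ _ _ _ | fixedˡ r≤a = ∧-intro (≤⇒≤ᵇ≡true 1≤r) (≤⇒≤ᵇ≡true (≤-trans r≤a (n≤1+n a)))
      ... | inRothe _ _ _ _ _ _ | first = ≤⇒≤ᵇ≡true {suc a} ≤-refl
      ... | inRothe _ _ _ _ r<w′⁻¹c c<w′r | shifted {r₀} a<r₀ r₀≤b = ⊥-elim (<-asym c<w[r₀] (subst (c <_) w′r≡ c<w′r))
        where
          w′r≡ : app w′ (suc r₀) ≡ app w r₀
          w′r≡ = trans (app-w′ (suc r₀)) (cong (app w) (cycle-shift a (suc k) r₀ a<r₀ r₀≤b))
          c<w[r₀] : app w r₀ < c
          c<w[r₀] = <-≤-trans (w-increasing r₀ (appInv w c) a<r₀ (s≤s⁻¹ (subst (suc r₀ <_) w′⁻¹c≡ r<w′⁻¹c)) (proj₂ x∈Block))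
                              (≤-reflexive (app-appInv w 1≤c c≤n))
      ... | inRothe _ _ _ _ r<w′⁻¹c _ | fixedʳ b+1<r =
            ⊥-elim (<⇒≱ (<-trans b+1<r (subst (r <_) w′⁻¹c≡ r<w′⁻¹c)) (s≤s (proj₂ x∈Block)))
      ⇐ : prefixᵇ (suc a) r ≡ true → rothe w′ r c ≡ true
      ⇐ e = InRothe⇒rothe-true w′ (inRothe 1≤r (≤-trans r≤a+1 (≤-trans (s≤s (<⇒≤ a<b)) b<n)) 1≤c c≤n
              (subst (r <_) (sym w′⁻¹c≡) (s≤s (≤-trans r≤a+1 (proj₁ x∈Block)))) (subst (c <_) (sym (app-w′ r)) c<wσr))
        where
          1≤r = ≤ᵇ≡true⇒≤ (∧-elimˡ e)
          r≤a+1 = ≤ᵇ≡true⇒≤ (∧-elimʳ {1 ≤ᵇ r} e)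
          c<wσr : c < app w (σ r)
          c<wσr with m≤n⇒m<n∨m≡n r≤a+1
          ... | inj₂ refl rewrite cycle-first a (suc k) = <-trans (s≤s c≤h) h+1<w[b+1]
          ... | inj₁ r<a+1 rewrite cycle-≤ a (suc k) r (s≤s⁻¹ r<a+1) = <-trans (s≤s c≤h) (h+1<w[≤a] r 1≤r (s≤s⁻¹ r<a+1))

  Dσ : Diagram
  Dσ r c = D (σ r) c

  low-column-σ : ∀ c → c ≤ L → ∀ r → Dσ r c ≡ D r c
  low-column-σ zero    _   r = trans (rothe-col-out w (σ r) 0 ((λ ()) ∘ proj₁)) (sym (rothe-col-out w r 0 ((λ ()) ∘ proj₁)))
  low-column-σ (suc c) c≤L r with aroundCycle a b r
  ... | fixedˡ r≤a = cong (λ r′ → D r′ (suc c)) (cycle-≤ a (suc k) r r≤a)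
  ... | first = trans (cong (λ r′ → D r′ (suc c)) (cycle-first a (suc k)))
                      (trans (low-column (suc c) (s≤s z≤n) c≤L (suc b) (s≤s (<⇒≤ a<b)) ≤-refl)
                             (sym (low-column (suc c) (s≤s z≤n) c≤L (suc a) ≤-refl (s≤s (<⇒≤ a<b)))))
  ... | shifted {r₀} a<r₀ r₀≤b = trans (cong (λ r′ → D r′ (suc c)) (cycle-shift a (suc k) r₀ a<r₀ r₀≤b))
                      (trans (low-column (suc c) (s≤s z≤n) c≤L r₀ a<r₀ (≤-trans r₀≤b (n≤1+n b)))
                             (sym (low-column (suc c) (s≤s z≤n) c≤L (suc r₀) (≤-trans a<r₀ (n≤1+n r₀)) (s≤s r₀≤b))))
  ... | fixedʳ b+1<r = cong (λ r′ → D r′ (suc c)) (cycle-> a (suc k) r b+1<r)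

  w′-low-column : ∀ c → c ≤ L → ∀ r → rothe w′ r c ≡ D r c
  w′-low-column c c≤L r = trans (w′-column c (λ (L<c , _) → <-irrefl refl (<-≤-trans L<c c≤L)) r) (low-column-σ c c≤L r)

  w′-low-colIs : ∀ c → c ≤ L → ∀ t → colIsᵇ n (rothe w′) c t ≡ colIsᵇ n D c t
  w′-low-colIs c c≤L t = colIs-cong n (rothe w′) D c c t (λ r _ _ → w′-low-column c c≤L r)

  top-colIs : ∀ c → Top c → ∀ t → colIsᵇ n D c t ≡ (t ≡ᵇ a)
  top-colIs c c∈Top t = colIs-unique n D c a t a<n (λ { (suc r) _ _ → top-column c c∈Top (suc r) })

  w′-top-colIs : ∀ c → Top c → ∀ t → colIsᵇ n (rothe w′) c t ≡ (t ≡ᵇ suc a)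
  w′-top-colIs c c∈Top t = colIs-unique n (rothe w′) c (suc a) t (≤-<-trans a<b b<n) (λ { (suc r) _ _ → w′-top-column c c∈Top (suc r) })

  -- in a column c > h, σ only moves the cell of row b+1 to row a+1
  high-column-σ : ∀ c → h < c → D (suc b) c ≡ false → ∀ r → Dσ r c ≡ D r c
  high-column-σ c h<c b+1∉ r with aroundCycle a b r
  ... | fixedˡ r≤a = cong (λ r′ → D r′ c) (cycle-≤ a (suc k) r r≤a)
  ... | first = trans (cong (λ r′ → D r′ c) (cycle-first a (suc k)))
                      (trans b+1∉ (sym (high-column c h<c (suc a) (≤-refl , a<b))))
  ... | shifted {r₀} a<r₀ r₀≤b = trans (cong (λ r′ → D r′ c) (cycle-shift a (suc k) r₀ a<r₀ r₀≤b)) (trans (high-column c h<c r₀ (a<r₀ , r₀≤b)) (sym (r+1∉ r₀≤b)))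
    where
      r+1∉ : r₀ ≤ b → D (suc r₀) c ≡ false
      r+1∉ r₀≤b with m≤n⇒m<n∨m≡n r₀≤b
      ... | inj₁ r₀<b = high-column c h<c (suc r₀) (≤-trans a<r₀ (n≤1+n r₀) , r₀<b)
      ... | inj₂ refl = b+1∉
  ... | fixedʳ b+1<r = cong (λ r′ → D r′ c) (cycle-> a (suc k) r b+1<r)

  high-colIs-σ : ∀ c → h < c → ∀ t → t ≢ suc a → colIsᵇ n Dσ c t ≡ colIsᵇ n D c t
  high-colIs-σ c h<c t t≢a+1 = true⇔true⇒≡
    (λ e → trans (sym (same (b+1∉⇐Dσ e))) e) (λ e → trans (same (b+1∉⇐D e)) e)
    where
      a+1≤n = ≤-trans a<b (<⇒≤ b<n)
      same : D (suc b) c ≡ false → colIsᵇ n Dσ c t ≡ colIsᵇ n D c t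
      same b+1∉ = colIs-cong n Dσ D c c t (λ r _ _ → high-column-σ c h<c b+1∉ r)
      a+1∉ : D (suc a) c ≡ false
      a+1∉ = high-column c h<c (suc a) (≤-refl , a<b)
      b+1∉⇐D : colIsᵇ n D c t ≡ true → D (suc b) c ≡ false
      b+1∉⇐D e = trans (colIs⇒ n D c t e (suc b) (s≤s z≤n) b<n) (≰⇒≤ᵇ≡false (<⇒≱ (≤-<-trans t≤a (s≤s (<⇒≤ a<b)))))
        where
          t≤a : t ≤ a
          t≤a with t ≤? a
          ... | yes t≤a = t≤a
          ... | no  t≰a = ⊥-elim (not-¬ a+1∉ (trans (colIs⇒ n D c t e (suc a) (s≤s z≤n) a+1≤n) (≤⇒≤ᵇ≡true (≰⇒> t≰a))))
      b+1∉⇐Dσ : colIsᵇ n Dσ c t ≡ true → D (suc b) c ≡ false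
      b+1∉⇐Dσ e = trans (sym (cong (λ r′ → D r′ c) (cycle-first a (suc k))))
                        (trans (colIs⇒ n Dσ c t e (suc a) (s≤s z≤n) a+1≤n) (≰⇒≤ᵇ≡false (<⇒≱ (s≤s t≤a))))
        where
          t≤a : t ≤ a
          t≤a with t ≤? a
          ... | yes t≤a = t≤a
          ... | no  t≰a = ⊥-elim (not-¬ (trans (cong (λ r′ → D r′ c) (cycle-shift a (suc k) (suc a) ≤-refl a<b)) a+1∉)
                  (trans (colIs⇒ n Dσ c t e (suc (suc a)) (s≤s z≤n) (≤-trans (s≤s a<b) b<n))
                         (≤⇒≤ᵇ≡true (≤∧≢⇒< (≰⇒> t≰a) (t≢a+1 ∘ sym)))))

  w′-high-colIs : ∀ c → h < c → ∀ t → t ≢ suc a → colIsᵇ n (rothe w′) c t ≡ colIsᵇ n D c t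
  w′-high-colIs c h<c t t≢a+1 =
    trans (colIs-cong n (rothe w′) Dσ c c t (λ r _ _ → w′-column c (λ (_ , c≤h) → <-irrefl refl (<-≤-trans h<c c≤h)) r))
          (high-colIs-σ c h<c t t≢a+1)

  D₀ : Diagram
  D₀ = emptyStdCols n D

  -- the diagram reached by the loop after the swaps b, b-1, …, a+1
  Y : Diagram
  Y r c = D₀ (σ r) c

  cleared-false : ∀ x {y} → y ≡ false → (if x then false else y) ≡ false
  cleared-false true  _   = refl
  cleared-false false y≡f = y≡f

  cleared-true : ∀ {x} y → x ≡ true → (if x then false else y) ≡ false
  cleared-true y refl = refl

  D₀-false : ∀ r c → D r c ≡ false → D₀ r c ≡ false
  D₀-false r c = cleared-false (nonemptyStdᵇ n D c)

  column-empty : ∀ c → colIsᵇ n D c 0 ≡ true → ∀ r → D r c ≡ false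
  column-empty c column≡∅ r with 1 ≤? r | r ≤? n
  ... | yes 1≤r | yes r≤n = trans (colIs⇒ n D c 0 column≡∅ r 1≤r r≤n) (≰⇒≤ᵇ≡false (<⇒≱ 1≤r))
  ... | no 1≰r  | _       = rothe-row-out w r c (1≰r ∘ proj₁)
  ... | yes _   | no r≰n  = rothe-row-out w r c (r≰n ∘ proj₂)

  -- colStdᵇ n D c unfolds to colIsᵇ n D c 0 ∨ nonemptyStdᵇ n D c
  D₀-≤h : ∀ c → 1 ≤ c → c ≤ h → ∀ r → D₀ r c ≡ false
  D₀-≤h c 1≤c c≤h r with nonemptyStdᵇ n D c in nonempty
  ... | true  = refl
  ... | false = column-empty c (trans (sym (∨-identityʳ _)) (subst (λ x → (colIsᵇ n D c 0 ∨ x) ≡ true) nonempty (standard≤h c 1≤c c≤h))) r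

  C-not-cleared : nonemptyStdᵇ n D (suc h) ≡ false
  C-not-cleared = ¬-not (λ e → not-¬ nonstandard (trans (cong (colIsᵇ n D (suc h) 0 ∨_) e) (∨-zeroʳ _)))

  D₀-C : ∀ r → D₀ r (suc h) ≡ D r (suc h)
  D₀-C r rewrite C-not-cleared = refl

  D₀-a+1 : ∀ c → D₀ (suc a) c ≡ false
  D₀-a+1 c with 1 ≤? c | c ≤? h
  ... | yes 1≤c | yes c≤h = D₀-≤h c 1≤c c≤h (suc a)
  ... | no 1≰c  | _       = D₀-false (suc a) c (rothe-col-out w (suc a) c (1≰c ∘ proj₁))
  ... | yes _   | no c≰h  = D₀-false (suc a) c (high-column c (≰⇒> c≰h) (suc a) (≤-refl , a<b))

  Y-≤h : ∀ c → 1 ≤ c → c ≤ h → ∀ r → Y r c ≡ false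
  Y-≤h c 1≤c c≤h r = D₀-≤h c 1≤c c≤h (σ r)

  w′-high-column : ∀ c → h < c → ∀ r → rothe w′ r c ≡ Dσ r c
  w′-high-column c h<c = w′-column c (λ (_ , c≤h) → <-irrefl refl (<-≤-trans h<c c≤h))

  high-standard : ∀ c → h < c → ∀ j → colIsᵇ n D c j ≡ true → j ≤ a
  high-standard c h<c j column≡[j] with j ≤? a
  ... | yes j≤a = j≤a
  ... | no  j≰a = ⊥-elim (not-¬ (high-column c h<c (suc a) (≤-refl , a<b))
          (trans (colIs⇒ n D c j column≡[j] (suc a) (s≤s z≤n) (≤-trans a<b (<⇒≤ b<n))) (≤⇒≤ᵇ≡true (≰⇒> j≰a))))

  final-diagram : emptyColsEq n Y (suc a) ≐ emptyStdCols n (rothe w′)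
  final-diagram r c with 1 ≤? c
  ... | no 1≰c = trans (cleared-false (colIsᵇ n Y c (suc a)) (D₀-false (σ r) c (rothe-col-out w (σ r) c (1≰c ∘ proj₁))))
                       (sym (cleared-false (nonemptyStdᵇ n (rothe w′) c) (rothe-col-out w′ r c (1≰c ∘ proj₁))))
  ... | yes 1≤c with columnView L h c
  ... | low c≤L = trans (cleared-false (colIsᵇ n Y c (suc a)) (Y-≤h c 1≤c c≤h r))
                        (sym (trans (cong₂ (λ u v → if u then false else v)
                                           (nonemptyStd-cong n (rothe w′) D c c (λ r _ _ → w′-low-column c c≤L r))
                                           (w′-low-column c c≤L r))
                                    (D₀-≤h c 1≤c c≤h r)))
    where c≤h = ≤-trans c≤L (<⇒≤ L<h)
  ... | top L<c c≤h = trans (cleared-false (colIsᵇ n Y c (suc a)) (Y-≤h c 1≤c c≤h r))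
                            (sym (cleared-true (rothe w′ r c)
                                   (nonemptyStd⁺ n (rothe w′) c (suc a) (s≤s z≤n) (≤-trans a<b (<⇒≤ b<n))
                                     (trans (w′-top-colIs c (L<c , c≤h) (suc a)) (≡⇒≡ᵇ≡true {suc a} refl)))))
  ... | high h<c with nonemptyStdᵇ n D c Bool.≟ true
  ... | yes cleared = trans (cleared-false (colIsᵇ n Y c (suc a)) (cleared-true (Dσ r c) cleared)) (sym (cleared-true (rothe w′ r c) w′-cleared))
    where
      w′-cleared : nonemptyStdᵇ n (rothe w′) c ≡ true
      w′-cleared with nonemptyStd⁻ n D c cleared
      ... | j , (1≤j , j≤n) , column≡[j] =
        nonemptyStd⁺ n (rothe w′) c j 1≤j j≤n (trans (w′-high-colIs c h<c j (λ e → <-irrefl e (s≤s (high-standard c h<c j column≡[j])))) column≡[j])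
  ... | no ¬cleared = cong₂ (λ u v → if u then false else v) same-test (trans (Y≐Dσ r) (sym (w′-high-column c h<c r)))
    where
      cleared = ¬-not ¬cleared
      Y≐Dσ : ∀ r → Y r c ≡ Dσ r c
      Y≐Dσ r = cong (λ u → if u then false else Dσ r c) cleared
      same-test : colIsᵇ n Y c (suc a) ≡ nonemptyStdᵇ n (rothe w′) c
      same-test = true⇔true⇒≡
        (λ e → nonemptyStd⁺ n (rothe w′) c (suc a) (s≤s z≤n) (≤-trans a<b (<⇒≤ b<n))
                 (trans (colIs-cong n (rothe w′) Y c c (suc a) (λ r _ _ → trans (w′-high-column c h<c r) (sym (Y≐Dσ r)))) e))
        ⇐
        where
          ⇐ : nonemptyStdᵇ n (rothe w′) c ≡ true → colIsᵇ n Y c (suc a) ≡ true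
          ⇐ e with nonemptyStd⁻ n (rothe w′) c e
          ... | j , (1≤j , j≤n) , column≡[j] with j ≟ suc a
          ... | yes refl = trans (colIs-cong n Y (rothe w′) c c (suc a) (λ r _ _ → trans (Y≐Dσ r) (sym (w′-high-column c h<c r)))) column≡[j]
          ... | no j≢a+1 = ⊥-elim (not-¬ cleared (nonemptyStd⁺ n D c j 1≤j j≤n (trans (sym (w′-high-colIs c h<c j j≢a+1)) column≡[j])))

  countCols≡count : ∀ X t → countCols n X t ≡ count (λ c → colIsᵇ n X c t) (range 0 n)
  countCols≡count X t = cong (count (λ c → colIsᵇ n X c t)) ([1,n]≡range n)

  isTop : ℕ → Bool
  isTop = between L h

  isTop-true : ∀ c → Top c → isTop c ≡ true
  isTop-true c (L<c , c≤h) = ∧-intro (<⇒<ᵇ≡true L<c) (≤⇒≤ᵇ≡true c≤h)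

  isTop-low : ∀ c → c ≤ L → isTop c ≡ false
  isTop-low c c≤L = cong (_∧ (c ≤ᵇ h)) (¬-not (λ e → <-irrefl refl (<-≤-trans (<ᵇ≡true⇒< e) c≤L)))

  isTop-high : ∀ c → h < c → isTop c ≡ false
  isTop-high c h<c = trans (cong ((L <ᵇ c) ∧_) (≰⇒≤ᵇ≡false (<⇒≱ h<c))) (∧-zeroʳ _)

  count-Top : count isTop (range 0 n) ≡ suc k
  count-Top = trans (count-between L h n (<⇒≤ L<h) (<⇒≤ h<n)) (trans (cong (_∸ L) (sym L+β≡h)) (m+n∸m≡n L (suc k)))

  low-column-long : ∀ c → 1 ≤ c → c ≤ L → ∀ t → t ≤ b → colIsᵇ n D c t ≡ false
  low-column-long c 1≤c c≤L t t≤b = ¬-not λ e → not-¬ (≰⇒≤ᵇ≡false (<⇒≱ (s≤s t≤b)))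
    (trans (sym (colIs⇒ n D c t e (suc b) (s≤s z≤n) b<n)) (low-column c 1≤c c≤L (suc b) (s≤s (<⇒≤ a<b)) ≤-refl))

  high-column-short : ∀ c → h < c → ∀ t → suc a ≤ t → colIsᵇ n D c t ≡ false
  high-column-short c h<c t a<t = ¬-not λ e → not-¬ (high-column c h<c (suc a) (≤-refl , a<b))
    (trans (colIs⇒ n D c t e (suc a) (s≤s z≤n) (≤-trans a<b (<⇒≤ b<n))) (≤⇒≤ᵇ≡true a<t))

  countCols-block : ∀ j → Block j → countCols n D j ≡ 0
  countCols-block j (a<j , j≤b) = trans (countCols≡count D j) (count-range-none _ 0 n none)
    where
      none : ∀ c → InRange 0 n c → colIsᵇ n D c j ≡ false
      none c (1≤c , _) with columnView L h c
      ... | low c≤L = low-column-long c 1≤c c≤L j j≤b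
      ... | top L<c c≤h = trans (top-colIs c (L<c , c≤h) j) (≢⇒≡ᵇ≡false (λ j≡a → <-irrefl (sym j≡a) a<j))
      ... | high h<c = high-column-short c h<c j a<j

  countCols-w′ : ∀ t → t ≢ a → t ≢ suc a → countCols n (rothe w′) t ≡ countCols n D t
  countCols-w′ t t≢a t≢a+1 = trans (countCols≡count (rothe w′) t)
    (trans (count-range-cong _ _ 0 n same) (sym (countCols≡count D t)))
    where
      same : ∀ c → InRange 0 n c → colIsᵇ n (rothe w′) c t ≡ colIsᵇ n D c t
      same c _ with columnView L h c
      ... | low c≤L = w′-low-colIs c c≤L t
      ... | top L<c c≤h = trans (w′-top-colIs c (L<c , c≤h) t)
            (trans (≢⇒≡ᵇ≡false t≢a+1) (sym (trans (top-colIs c (L<c , c≤h) t) (≢⇒≡ᵇ≡false t≢a))))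
      ... | high h<c = w′-high-colIs c h<c t t≢a+1

  countCols-a : countCols n D a ≡ countCols n (rothe w′) a + suc k
  countCols-a = trans (countCols≡count D a)
    (trans (count-range-∨ _ _ _ 0 n split disjoint) (cong₂ _+_ (sym (countCols≡count (rothe w′) a)) count-Top))
    where
      a≢a+1 : a ≢ suc a
      a≢a+1 = <⇒≢ (n<1+n a)
      split : ∀ c → InRange 0 n c → colIsᵇ n D c a ≡ (colIsᵇ n (rothe w′) c a ∨ isTop c)
      split c _ with columnView L h c
      ... | low c≤L rewrite isTop-low c c≤L | w′-low-colIs c c≤L a = sym (∨-identityʳ _)
      ... | top L<c c≤h rewrite isTop-true c (L<c , c≤h) | top-colIs c (L<c , c≤h) a | ≡⇒≡ᵇ≡true {a} refl = sym (∨-zeroʳ _)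
      ... | high h<c rewrite isTop-high c h<c | w′-high-colIs c h<c a a≢a+1 = sym (∨-identityʳ _)
      disjoint : ∀ c → InRange 0 n c → colIsᵇ n (rothe w′) c a ≡ true → isTop c ≡ false
      disjoint c _ e with columnView L h c
      ... | low c≤L = isTop-low c c≤L
      ... | top L<c c≤h = ⊥-elim (a≢a+1 (≡ᵇ≡true⇒≡ (trans (sym (w′-top-colIs c (L<c , c≤h) a)) e)))
      ... | high h<c = isTop-high c h<c

  countCols-a+1 : countCols n (rothe w′) (suc a) ≡ suc k + countCols n Y (suc a)
  countCols-a+1 = trans (countCols≡count (rothe w′) (suc a))
    (trans (count-range-∨ _ _ _ 0 n split disjoint) (cong₂ _+_ count-Top (sym (countCols≡count Y (suc a)))))
    where
      a+1≤n = ≤-trans a<b (<⇒≤ b<n)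
      Y-not-[a+1] : ∀ c → (∀ r → Y r c ≡ false) → colIsᵇ n Y c (suc a) ≡ false
      Y-not-[a+1] c empty = ¬-not λ e → not-¬ (empty 1) (colIs⇒ n Y c (suc a) e 1 ≤-refl (≤-trans (s≤s z≤n) a+1≤n))
      split : ∀ c → InRange 0 n c → colIsᵇ n (rothe w′) c (suc a) ≡ (isTop c ∨ colIsᵇ n Y c (suc a))
      split c (1≤c , _) with columnView L h c
      ... | low c≤L rewrite isTop-low c c≤L | Y-not-[a+1] c (Y-≤h c 1≤c (≤-trans c≤L (<⇒≤ L<h))) =
            trans (w′-low-colIs c c≤L (suc a)) (low-column-long c 1≤c c≤L (suc a) a<b)
      ... | top L<c c≤h rewrite isTop-true c (L<c , c≤h) = trans (w′-top-colIs c (L<c , c≤h) (suc a)) (≡⇒≡ᵇ≡true {suc a} refl)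
      ... | high h<c rewrite isTop-high c h<c with nonemptyStdᵇ n D c Bool.≟ true
      ... | no ¬cleared = colIs-cong n (rothe w′) Y c c (suc a)
            (λ r _ _ → trans (w′-high-column c h<c r) (sym (cong (λ u → if u then false else Dσ r c) (¬-not ¬cleared))))
      ... | yes cleared with nonemptyStd⁻ n D c cleared
      ... | j , (1≤j , j≤n) , column≡[j] = trans
            (¬-not λ e → <-irrefl refl (≤-trans (colIs-≤ n (rothe w′) c j (suc a) w′-column≡[j] e (s≤s z≤n) a+1≤n) j≤a))
            (sym (Y-not-[a+1] c (λ r → cleared-true (Dσ r c) cleared)))
        where
          j≤a = high-standard c h<c j column≡[j]
          w′-column≡[j] = trans (w′-high-colIs c h<c j (λ e → <-irrefl e (s≤s j≤a))) column≡[j]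
      disjoint : ∀ c → InRange 0 n c → isTop c ≡ true → colIsᵇ n Y c (suc a) ≡ false
      disjoint c (1≤c , _) e with columnView L h c
      ... | low c≤L = ⊥-elim (not-¬ (isTop-low c c≤L) e)
      ... | top _ c≤h = Y-not-[a+1] c (Y-≤h c 1≤c c≤h)
      ... | high h<c = ⊥-elim (not-¬ (isTop-high c h<c) e)

  -- the diagram after the swaps b, b-1, …, x+1, where x + e = b
  Stage : ℕ → ℕ → Diagram
  Stage x e r c = D₀ (cycle x e r) c

  module AtStage (x e : ℕ) (a<x : suc a ≤ x) (x+e≡b : x + e ≡ b) (Z : Diagram) (Z≐ : Z ≐ Stage x e) where

    x≤b : x ≤ b
    x≤b = ≤-trans (m≤m+n x e) (≤-reflexive x+e≡b)

    C-rows : ∀ r → Z r (suc h) ≡ D (cycle x e r) (suc h)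
    C-rows r = trans (Z≐ r (suc h)) (D₀-C (cycle x e r))

    x+1∈C : Z (suc x) (suc h) ≡ true
    x+1∈C = trans (C-rows (suc x)) (trans (cong (λ r → D r (suc h)) (trans (cycle-first x e) (cong suc x+e≡b))) b+1∈C)

    C-rows-≤x : ∀ r → r ≤ x → Z r (suc h) ≡ D r (suc h)
    C-rows-≤x r r≤x = trans (C-rows r) (cong (λ r′ → D r′ (suc h)) (cycle-≤ x e r r≤x))

    leftmost : LeftmostNonempty n Z (suc h)
    leftmost = s≤s z≤n , h<n ,
      ¬-not (λ e′ → not-¬ (≰⇒≤ᵇ≡false {suc x} {0} (λ ())) (trans (sym (colIs⇒ n Z (suc h) 0 e′ (suc x) (s≤s z≤n) (≤-trans (s≤s x≤b) b<n))) x+1∈C)) ,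
      (λ c′ 1≤c′ c′<h+1 → ⇒colIs n Z c′ 0 (λ r 1≤r _ →
        trans (Z≐ r c′) (trans (D₀-≤h c′ 1≤c′ (s≤s⁻¹ c′<h+1) (cycle x e r)) (sym (≰⇒≤ᵇ≡false (<⇒≱ 1≤r))))))

    tooth : SmallestMissingTooth Z (suc h) x
    tooth = (≤-trans (s≤s z≤n) a<x , trans (C-rows-≤x x ≤-refl) (block∉C x a<x x≤b) , x+1∈C) ,
            (λ i i<x (1≤i , i∉ , i+1∈) → not-tooth i i<x 1≤i i∉ i+1∈)
      where
        not-tooth : ∀ i → i < x → 1 ≤ i → Z i (suc h) ≡ false → Z (suc i) (suc h) ≡ true → ⊥
        not-tooth i i<x 1≤i i∉ i+1∈ with i ≤? a
        ... | yes i≤a = not-¬ i∉ (trans (C-rows-≤x i (<⇒≤ i<x)) ([a]⊆C i 1≤i i≤a))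
        ... | no  i≰a = not-¬ (trans (C-rows-≤x (suc i) i<x) (block∉C (suc i) (≤-trans (≰⇒> i≰a) (n≤1+n i)) (≤-trans i<x x≤b))) i+1∈

    nonempty : ¬ AllEmpty n Z
    nonempty empty = not-¬ (proj₁ (proj₂ (proj₂ leftmost))) (empty (suc h) (s≤s z≤n) h<n)

  swap-Stage : ∀ x e {Z} → Z ≐ Stage (suc x) e → swapRows (suc x) Z ≐ Stage x (suc e)
  swap-Stage x e {Z} Z≐ r c =
    trans (swapRows≡swap (suc x) Z r c) (trans (Z≐ (swap (suc x) r) c) (cong (λ r′ → D₀ r′ c) (sym (cycle-suc x e r))))

  -- before the last of these swaps, row a+1 is empty, so no column is a standard interval [t] with t > a
  Stage-no-long-column : ∀ x e t → suc a ≤ x → suc a ≤ t → ∀ c → colIsᵇ n (Stage x e) c t ≡ false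
  Stage-no-long-column x e t a<x a<t c = ¬-not λ e′ → not-¬
    (trans (cong (λ r → D₀ r c) (cycle-≤ x e (suc a) a<x)) (D₀-a+1 c))
    (trans (colIs⇒ n (Stage x e) c t e′ (suc a) (s≤s z≤n) (≤-trans a<b (<⇒≤ b<n))) (≤⇒≤ᵇ≡true a<t))

  record LoopPrefix (d : ℕ) (is ms : List ℕ) : Set where
    field
      swaps : ∀ j → 1 ≤ j → j ≤ suc d → is ! j ≡ just (suc (suc (d + a) ∸ j))
      zeros : ∀ j → 1 ≤ j → j ≤ d → ms ! j ≡ just 0
      last  : ms ! suc d ≡ just (countCols n Y (suc a))
      rest  : OrthoLoop n (emptyColsEq n Y (suc a)) (drop (suc d) is) (drop (suc d) ms)

  loop : ∀ d e Z is ms → suc (d + a) + e ≡ b → Z ≐ Stage (suc (d + a)) e → OrthoLoop n Z is ms → LoopPrefix d is ms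
  loop d e Z [] [] x+e≡b Z≐ (done empty) = ⊥-elim (AtStage.nonempty (suc (d + a)) e (s≤s (m≤n+m a d)) x+e≡b Z Z≐ empty)
  loop d e Z (i ∷ is) (_ ∷ ms) x+e≡b Z≐ (step lm smt rest)
    with SmallestMissingTooth-unique Z (suc h)
           (subst (λ c → SmallestMissingTooth Z c i) (LeftmostNonempty-unique n Z lm S.leftmost) smt) S.tooth
    where module S = AtStage (suc (d + a)) e (s≤s (m≤n+m a d)) x+e≡b Z Z≐
  loop zero e Z (.(suc a) ∷ is) (_ ∷ ms) x+e≡b Z≐ (step _ _ rest) | refl with +-cancelˡ-≡ a e k (suc-injective (trans x+e≡b (+-suc a k)))
  ... | refl = record
    { swaps = λ { (suc zero) _ _ → refl ; (suc (suc j)) _ (s≤s ()) }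
    ; zeros = λ j 1≤j j≤0 → ⊥-elim (<-irrefl refl (≤-trans 1≤j j≤0))
    ; last  = cong just (countCols-≐ n (suc a) swapped≐Y)
    ; rest  = OrthoLoop-≐ n (emptyColsEq-≐ n (suc a) swapped≐Y) rest
    }
    where
      swapped≐Y : swapRows (suc a) Z ≐ Y
      swapped≐Y = swap-Stage a k Z≐
  loop (suc d) e Z (.(suc (suc (d + a))) ∷ is) (_ ∷ ms) x+e≡b Z≐ (step _ _ rest) | refl = record
    { swaps = λ { (suc zero) _ _ → refl ; (suc (suc j)) _ (s≤s j≤) → LoopPrefix.swaps IH (suc j) (s≤s z≤n) j≤ }
    ; zeros = λ { (suc zero) _ _ → cong just none ; (suc (suc j)) _ (s≤s j≤) → LoopPrefix.zeros IH (suc j) (s≤s z≤n) j≤ }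
    ; last  = LoopPrefix.last IH
    ; rest  = LoopPrefix.rest IH
    }
    where
      x = suc (suc (d + a))
      swapped≐ : swapRows x Z ≐ Stage (suc (d + a)) (suc e)
      swapped≐ = swap-Stage (suc (d + a)) e Z≐
      not-[x] : ∀ c → colIsᵇ n (swapRows x Z) c x ≡ false
      not-[x] c = trans (colIs-≐ n c x swapped≐)
        (Stage-no-long-column (suc (d + a)) (suc e) x (s≤s (m≤n+m a d)) (s≤s (≤-trans (m≤n+m a d) (n≤1+n _))) c)
      none : countCols n (swapRows x Z) x ≡ 0
      none = trans (cong (count _) ([1,n]≡range n)) (count-range-none _ 0 n (λ c _ → not-[x] c))
      cleared≐ : emptyColsEq n (swapRows x Z) x ≐ Stage (suc (d + a)) (suc e)
      cleared≐ r c = trans (cong (λ u → if u then false else swapRows x Z r c) (not-[x] c)) (swapped≐ r c)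
      IH = loop d (suc e) (emptyColsEq n (swapRows x Z) x) is ms (trans (cong suc (+-suc (d + a) e)) x+e≡b) cleared≐ rest

  conclusion : ∀ is ks ms → Orthodontic w is ks ms → Conclusion w is ks ms a b (suc k)
  conclusion is .(map (countCols n D) [1, n ]) ms (refl , orthoLoop) =
    (λ j 1≤j j≤β → trans (LoopPrefix.swaps prefix j 1≤j j≤β) (cong (λ i → just (suc (i ∸ j))) k+a+1≡b′)) ,
    (λ 1≤a → ≤-trans (m≤n+m (suc k) _)
               (≤-reflexive (sym (trans (cong (λ js → at (map K js) a) ([1,n]≡range n))
                                        (trans (at-map-range K 0 n a 1≤a (<⇒≤ a<n)) countCols-a))))) ,
    (λ j a<j j≤b → trans (cong (λ js → map K js ! j) ([1,n]≡range n))
                     (trans (!-map-range K 0 n j (≤-trans (s≤s z≤n) a<j) (≤b⇒≤n j≤b)) (cong just (countCols-block j (a<j , j≤b))))) ,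
    LoopPrefix.zeros prefix ,
    (countCols n Y (suc a) , LoopPrefix.last prefix ,
     sym (newK-correct n K (countCols n (rothe w′)) a (suc k) _ (λ t _ → countCols-w′ t) countCols-a countCols-a+1) ,
     OrthoLoop-≐ n final-diagram (LoopPrefix.rest prefix))
    where
      K = countCols n D
      k+a+1≡b′ : suc (k + a) ≡ b
      k+a+1≡b′ = trans (cong suc (+-comm k a)) (sym (+-suc a k))
      prefix = loop k 0 D₀ is ms (trans (+-identityʳ _) k+a+1≡b′) (λ _ _ → refl) orthoLoop

module _ {n} (w : Permutation′ n) (increasing : SortedOn w 0 n) where

  ≤w : ∀ r → 1 ≤ r → r ≤ n → r ≤ app w r
  ≤w (suc zero)    _ r≤n = proj₁ (app-range w (s≤s z≤n) r≤n)
  ≤w (suc (suc r)) _ r≤n = ≤-trans (s≤s (≤w (suc r) (s≤s z≤n) (≤-trans (n≤1+n _) r≤n))) (increasing (suc r) (s≤s z≤n) r≤n)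

  w≤ : ∀ d r → d + r ≡ n → 1 ≤ r → app w r ≤ r
  w≤ zero    r r≡n 1≤r = ≤-trans (proj₂ (app-range w 1≤r (≤-reflexive r≡n))) (≤-reflexive (sym r≡n))
  w≤ (suc d) r d+r≡n 1≤r =
    s≤s⁻¹ (≤-trans (increasing r 1≤r (≤-trans (s≤s (m≤n+m r d)) (≤-reflexive d+r≡n))) (w≤ d (suc r) (trans (+-suc d r) d+r≡n) (s≤s z≤n)))

  increasing⇒identity : IsIdentity w
  increasing⇒identity i = Finₚ.toℕ-injective (suc-injective (trans (sym (app-toℕ w i))
    (≤-antisym (w≤ (n ∸ r) r (m∸n+n≡m r≤n) (s≤s z≤n)) (≤w r (s≤s z≤n) r≤n))))
    where
      r = suc (toℕ i)
      r≤n = Finₚ.toℕ<n i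

below-tooth∉ : ∀ (D : Diagram) c α i₁ → D (suc α) c ≡ false → SmallestMissingTooth D c i₁ →
               ∀ r → suc α ≤ r → r ≤ i₁ → D r c ≡ false
below-tooth∉ D c α i₁ α+1∉ (_ , smallest) r α<r r≤i₁ =
  subst (λ r → D r c ≡ false) (m∸n+n≡m α<r) (go (r ∸ suc α) (≤-trans (≤-reflexive (m∸n+n≡m α<r)) r≤i₁))
  where
    go : ∀ d → d + suc α ≤ i₁ → D (d + suc α) c ≡ false
    go zero    _  = α+1∉
    go (suc d) ≤i₁ = ¬-not λ e → smallest (d + suc α) ≤i₁ (≤-trans (s≤s z≤n) (m≤n+m (suc α) d) , go d (≤-trans (n≤1+n _) ≤i₁) , e)

theorem4p2 : ∀ {n} (w : Permutation′ n) (is ks ms : List ℕ) {h α i₁ β : ℕ} →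
  ¬ IsIdentity w → Sorted w →
  Orthodontic w is ks ms → PrimaryData w h α i₁ β →
  -- (i)
  (∀ j → 1 ≤ j → j ≤ β → is ! j ≡ just (suc (i₁ ∸ j))) ×
  -- (ii)
  (1 ≤ α → at ks α ≥ β) ×
  -- (iii)
  (∀ j → suc α ≤ j → j ≤ i₁ → ks ! j ≡ just 0) ×
  -- (iv)
  (∀ j → 1 ≤ j → j ≤ β ∸ 1 → ms ! j ≡ just 0) ×
  -- (v)
  (∃ λ mβ → ms ! β ≡ just mβ ×
    Orthodontic (w ·sList descending α i₁)
                (drop β is) (newK n ks α β mβ) (drop β ms))
theorem4p2 w is ks ms ¬identity sorted ortho (dominant dom) =
  ⊥-elim (¬identity (increasing⇒identity w (sorted (dominant dom))))
theorem4p2 w is ks ms ¬identity sorted ortho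
  pd@(nondominant {h} {α} {i₁} h<n standard≤h nonstandard [α]⊆C α+1∉C tooth@((1≤i₁ , i₁∉C , i₁+1∈C) , _)) =
  conclude (i₁ ∸ suc α) (trans (+-suc α _) (m+[n∸m]≡n α<i₁))
           (below-tooth∉ (rothe w) (suc h) α i₁ α+1∉C tooth) i₁+1∈C (sorted pd)
  where
    α<i₁ : α < i₁
    α<i₁ with α <? i₁
    ... | yes α<i₁ = α<i₁
    ... | no  α≮i₁ = ⊥-elim (not-¬ i₁∉C ([α]⊆C i₁ 1≤i₁ (≮⇒≥ α≮i₁)))
    conclude : ∀ k {i} → α + suc k ≡ i → (∀ r → suc α ≤ r → r ≤ i → rothe w r (suc h) ≡ false) →
               rothe w (suc i) (suc h) ≡ true → SortedOn w α i → Conclusion w is ks ms α i (i ∸ α)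
    conclude k refl block∉C b+1∈C increasing = subst (Conclusion w is ks ms α (α + suc k)) (sym (m+n∸m≡n α (suc k)))
      (PrimaryColumn.conclusion w h α k h<n standard≤h nonstandard [α]⊆C block∉C b+1∈C increasing is ks ms ortho)
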